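{- Let $G$ be a cubic graph, let $M_1, M_2, M_3$ be three pairwise different 1-factors of $G$, let $\mathcal{M} = \bigcup_{i \neq j}(M_i \cap M_j)$, $\mathcal{U} = E(G) - (M_1 \cup M_2 \cup M_3)$, and let $G_c = G[\mathcal{M} \cup \mathcal{U}]$ be the core of $G$ with respect to $M_1, M_2, M_3$. Let $K_c$ be a component of $G_c$. Then $\mathcal{M}$ is a 1-factor of $G_c$, and (1) $K_c$ is either an even circuit or a subdivision of a cubic multigraph $K$; (2) if $K_c$ is a subdivision of a cubic multigraph $K$, then $E(K_c) \cap M_1 \cap M_2 \cap M_3$ is a 1-factor of $K$ (where $K$ is obtained from $K_c$ by suppressing the vertices of degree 2, and the edges of $M_1\cap M_2\cap M_3$, whose endpoints have degree 3 in $K_c$, are edges of $K$).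
   Context: Graphs are finite, may have parallel edges, but no loops; multigraphs may additionally have loops. A 1-factor is a spanning 1-regular subgraph, identified with its edge set. For $X \subseteq E(G)$, $G[X]$ is the graph with edge set $X$ and vertex set all endpoints of edges of $X$. A circuit is a connected 2-regular graph; it is even if it has even length. -}

module Defs where

open import Data.Nat using (ℕ; zero; suc; _+_)
open import Data.Nat.Divisibility using (_∣_)
open import Data.Bool using (Bool; true; false; if_then_else_; _∧_)
open import Data.Fin using (Fin; zero; suc; fromℕ; inject₁; toℕ; _≟_)
open import Data.Fin.Subset using (Subset; _∈_; _∩_; _∪_; ∁; ⊤) renaming (∣_∣ to card)
open import Data.Vec using (lookup; tabulate)
open import Data.Product using (Σ; ∃; _×_; _,_; proj₁; proj₂)
open import Data.Sum using (_⊎_)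
open import Relation.Nullary using (¬_; does)
open import Relation.Binary.PropositionalEquality using (_≡_; _≢_)

∑ : ∀ {k} → (Fin k → ℕ) → ℕ
∑ {zero} f = 0
∑ {suc k} f = f zero + ∑ (λ i → f (suc i))

-- A multigraph (loops and parallel edges allowed) with vertices Fin n and
-- edges Fin m; each edge has an (unordered) pair of endpoints.
record Multigraph (n m : ℕ) : Set where
  field
    ends : Fin m → Fin n × Fin n

open Multigraph public

record Graph (n m : ℕ) : Set where
  field
    mg : Multigraph n m
    loopless : ∀ e → proj₁ (ends mg e) ≢ proj₂ (ends mg e)

open Graph public

-- number of ends of edge with endpoints (a , b) at v (a loop counts twice)
inc : ∀ {n} → Fin n × Fin n → Fin n → ℕ
inc (a , b) v = (if does (a ≟ v) then 1 else 0) + (if does (b ≟ v) then 1 else 0)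

degree : ∀ {n m} → Multigraph n m → Subset m → Fin n → ℕ
degree H X v = ∑ (λ e → if lookup X e then inc (ends H e) v else 0)

Cubic : ∀ {n m} → Multigraph n m → Set
Cubic H = ∀ v → degree H ⊤ v ≡ 3

OneFactor : ∀ {n m} → Multigraph n m → Subset m → Set
OneFactor H X = ∀ v → degree H X v ≡ 1

Joins : ∀ {n m} → Multigraph n m → Fin m → Fin n → Fin n → Set
Joins H e u w = (ends H e ≡ (u , w)) ⊎ (ends H e ≡ (w , u))

-- v is an endpoint of some edge in X, i.e. v ∈ V(G[X])
InV : ∀ {n m} → Multigraph n m → Subset m → Fin n → Set
InV H X v = ∃ λ e → e ∈ X × ((proj₁ (ends H e) ≡ v) ⊎ (proj₂ (ends H e) ≡ v))

data Reach {n m} (H : Multigraph n m) (X : Subset m) : Fin n → Fin n → Set where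
  here : ∀ {u} → Reach H X u u
  step : ∀ {u w v} (e : Fin m) → e ∈ X → Joins H e u w → Reach H X w v → Reach H X u v

record IsComponent {n m} (H : Multigraph n m) (X : Subset m) (C : Subset n) : Set where
  field
    nonempty  : ∃ λ v → v ∈ C
    inV       : ∀ v → v ∈ C → InV H X v
    connected : ∀ u v → u ∈ C → v ∈ C → Reach H X u v
    closed    : ∀ e u w → e ∈ X → Joins H e u w → u ∈ C → w ∈ C

compEdges : ∀ {n m} → Multigraph n m → Subset m → Subset n → Subset m
compEdges H X C = tabulate (λ e → lookup X e ∧ (lookup C (proj₁ (ends H e)) ∧ lookup C (proj₂ (ends H e))))

record IsEvenCircuit {n m} (H : Multigraph n m) (C : Subset n) (F : Subset m) : Set where
  field
    nonempty  : ∃ λ v → v ∈ C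
    regular2  : ∀ v → v ∈ C → degree H F v ≡ 2
    connected : ∀ u v → u ∈ C → v ∈ C → Reach H F u v
    evenLen   : 2 ∣ card F

-- internal vertex positions 1 .. len of a path with vertices 0 .. len+1
inner : ∀ {k} → Fin k → Fin (suc (suc k))
inner i = suc (inject₁ i)

-- The graph (C , F) (a subgraph of H) is a subdivision of the multigraph K:
-- the vertices of K are mapped injectively to branch vertices, every edge f of K
-- is replaced by a path with suc (len f) edges between the images of its ends,
-- whose internal vertices are new (not branch vertices), such that the paths'
-- edges partition F and the internal vertices together with the branch
-- vertices partition C.
record Subdivision {n m p q} (H : Multigraph n m) (C : Subset n) (F : Subset m)
                   (K : Multigraph p q) : Set where
  field
    branch       : Fin p → Fin n
    branch-inj   : ∀ x y → branch x ≡ branch y → x ≡ y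
    branch-in    : ∀ x → branch x ∈ C
    len          : Fin q → ℕ
    pedge        : (f : Fin q) → Fin (suc (len f)) → Fin m
    pvert        : (f : Fin q) → Fin (suc (suc (len f))) → Fin n
    pvert-start  : ∀ f → pvert f zero ≡ branch (proj₁ (ends K f))
    pvert-end    : ∀ f → pvert f (fromℕ (suc (len f))) ≡ branch (proj₂ (ends K f))
    pedge-joins  : ∀ f i → Joins H (pedge f i) (pvert f (inject₁ i)) (pvert f (suc i))
    pedge-in     : ∀ f i → pedge f i ∈ F
    pedge-cover  : ∀ e → e ∈ F → ∃ λ f → ∃ λ i → pedge f i ≡ e
    pedge-unique : ∀ f i g j → pedge f i ≡ pedge g j → (f ≡ g) × (toℕ i ≡ toℕ j)
    inner-in     : ∀ f (i : Fin (len f)) → pvert f (inner i) ∈ C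
    inner-new    : ∀ f (i : Fin (len f)) x → pvert f (inner i) ≢ branch x
    inner-unique : ∀ f (i : Fin (len f)) g (j : Fin (len g)) →
                   pvert f (inner i) ≡ pvert g (inner j) → (f ≡ g) × (toℕ i ≡ toℕ j)
    vert-cover   : ∀ v → v ∈ C →
                   (∃ λ x → branch x ≡ v) ⊎ (∃ λ f → ∃ λ (i : Fin (len f)) → pvert f (inner i) ≡ v)

𝓜 : ∀ {m} → Subset m → Subset m → Subset m → Subset m
𝓜 M₁ M₂ M₃ = ((M₁ ∩ M₂) ∪ (M₁ ∩ M₃)) ∪ (M₂ ∩ M₃)

𝓤 : ∀ {m} → Subset m → Subset m → Subset m → Subset m
𝓤 M₁ M₂ M₃ = ∁ ((M₁ ∪ M₂) ∪ M₃)

coreEdges : ∀ {m} → Subset m → Subset m → Subset m → Subset m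
coreEdges M₁ M₂ M₃ = 𝓜 M₁ M₂ M₃ ∪ 𝓤 M₁ M₂ M₃

-- the set of edges of K whose path in the subdivision is a single edge lying in T
-- (i.e. edges of T in K_c viewed as edges of K)
liftedEdges : ∀ {n m p q} {H : Multigraph n m} {C : Subset n} {F : Subset m}
              {K : Multigraph p q} → Subdivision H C F K → Subset m → Subset q
liftedEdges s T = tabulate (λ f → does (Subdivision.len s f Data.Nat.≟ 0) ∧ lookup T (Subdivision.pedge s f zero))

-- Each 1-factor Mᵢ contains exactly one of the three edges at a vertex v. Running through the 27
-- possibilities shows that v has degree 0, 2 or 3 in the core, that exactly one core edge at v lies in 𝓜
-- when the degree is not 0, and that the degree is 3 exactly when an edge of M₁ ∩ M₂ ∩ M₃ is at v.
-- So a component of the core has degrees 2 and 3 and the perfect matching 𝓜. Without vertices of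
-- degree 3 it is connected and 2-regular, with twice as many edges as 𝓜: an even circuit. Otherwise
-- the maximal walks through vertices of degree 2 join vertices of degree 3 and exhibit the component as
-- a subdivision of a cubic multigraph K. An edge of M₁ ∩ M₂ ∩ M₃ joins two vertices of degree 3, so
-- it is an edge of K, and every vertex of K meets exactly one of them.

module Submission where

open import Defs
open import Data.Bool using (Bool; true; false; if_then_else_; not; _∧_; _∨_)
open import Data.Bool.Properties using (not-involutive; ∧-conicalˡ; ∧-conicalʳ; ∧-zeroʳ) renaming (_≟_ to _≟ᵇ_)
open import Data.Empty using (⊥; ⊥-elim)
open import Data.Fin using (Fin; zero; suc; _≟_; fromℕ; fromℕ<; inject₁; toℕ; splitAt; join)
open import Data.Fin.Properties using (any?; pigeonhole; splitAt-join; join-splitAt; suc-injective; toℕ-injective; toℕ-fromℕ; toℕ-fromℕ<; toℕ-inject₁; toℕ<n)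
open import Data.Fin.Subset using (Subset; _∈_; _∩_; _∪_; ∁; ⊤) renaming (∣_∣ to card)
open import Data.Nat using (ℕ; zero; suc; pred; _+_; _*_; _∸_; _≤_; _<_; z≤n; s≤s; _≤?_) renaming (_≟_ to _≟ℕ_)
open import Data.Nat.Divisibility using (_∣_; divides)
open import Data.Nat.Properties using (+-assoc; +-cancelˡ-≡; 0≢1+n; +-comm; +-suc; +-identityʳ; *-comm; ≤-refl; ≤-trans; ≤-antisym; <⇒≤; m≤n⇒m<n∨m≡n; m∸n+n≡m; m∸n≤m; m≤m+n; m≤n+m; ≤-pred; ≤-total; m≤n⇒∃[o]m+o≡n)
open import Algebra.Properties.CommutativeSemigroup Data.Nat.Properties.+-commutativeSemigroup using (interchange)
open import Data.Product using (Σ; ∃; ∃₂; _×_; _,_; proj₁; proj₂)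
open import Data.Product.Properties using (≡-dec)
open import Data.Sum using (_⊎_; inj₁; inj₂; [_,_])
open import Data.Vec using ([]; _∷_; lookup)
open import Data.Vec.Properties using ([]=⇒lookup; lookup⇒[]=; lookup-zipWith; lookup∘tabulate; lookup-replicate; lookup-map)
open import Function using (_∘_; id)
open import Relation.Nullary using (¬_; Dec; does; yes; no; _×-dec_)
open import Relation.Binary.PropositionalEquality hiding ([_])

-- Sums over Fin

bit : Bool → ℕ
bit true = 1
bit false = 0

false≢true : false ≢ true
false≢true ()

indicator : ∀ {A : Set} → Dec A → ℕ
indicator d = if does d then 1 else 0

indicator-yes : ∀ {A : Set} (d : Dec A) → A → indicator d ≡ 1
indicator-yes (yes _) _ = refl
indicator-yes (no ¬a) a = ⊥-elim (¬a a)

indicator-no : ∀ {A : Set} (d : Dec A) → ¬ A → indicator d ≡ 0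
indicator-no (yes a) ¬a = ⊥-elim (¬a a)
indicator-no (no _) _ = refl

∑-cong : ∀ {k} {f g : Fin k → ℕ} → (∀ i → f i ≡ g i) → ∑ f ≡ ∑ g
∑-cong {zero} h = refl
∑-cong {suc k} h = cong₂ _+_ (h zero) (∑-cong (λ i → h (suc i)))

∑-+ : ∀ {k} (f g : Fin k → ℕ) → ∑ (λ i → f i + g i) ≡ ∑ f + ∑ g
∑-+ {zero} f g = refl
∑-+ {suc k} f g = trans (cong ((f zero + g zero) +_) (∑-+ (λ i → f (suc i)) (λ i → g (suc i))))
  (interchange (f zero) (g zero) (∑ (λ i → f (suc i))) (∑ (λ i → g (suc i))))

∑-zero : ∀ {k} (f : Fin k → ℕ) → (∀ i → f i ≡ 0) → ∑ f ≡ 0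
∑-zero {zero} f h = refl
∑-zero {suc k} f h rewrite h zero = ∑-zero (λ i → f (suc i)) (λ i → h (suc i))

∑≡0⇒zero : ∀ {k} (f : Fin k → ℕ) → ∑ f ≡ 0 → ∀ i → f i ≡ 0
∑≡0⇒zero {suc k} f h zero with f zero | h
... | zero | _ = refl
∑≡0⇒zero {suc k} f h (suc i) with f zero | h
... | zero | h′ = ∑≡0⇒zero (λ i → f (suc i)) h′ i

∑-swap : ∀ {k l} (g : Fin k → Fin l → ℕ) → ∑ (λ i → ∑ (λ j → g i j)) ≡ ∑ (λ j → ∑ (λ i → g i j))
∑-swap {zero} {l} g = sym (∑-zero {l} (λ j → 0) (λ j → refl))
∑-swap {suc k} {l} g = trans (cong (∑ (g zero) +_) (∑-swap (λ i j → g (suc i) j)))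
  (sym (∑-+ (λ j → g zero j) (λ j → ∑ (λ i → g (suc i) j))))

∑-single : ∀ {k} (a : Fin k) (c : ℕ) → ∑ (λ i → if does (i ≟ a) then c else 0) ≡ c
∑-single {suc k} zero c =
  trans (cong (c +_) (∑-zero {k} (λ i → if does (suc i ≟ zero) then c else 0) (λ i → refl))) (+-identityʳ c)
∑-single {suc k} (suc a) c = ∑-single a c

∑-single′ : ∀ {k} (a : Fin k) → ∑ (λ i → indicator (a ≟ i)) ≡ 1
∑-single′ {suc k} zero = cong suc (∑-zero {k} (λ i → indicator (zero ≟ suc i)) (λ i → refl))
∑-single′ {suc k} (suc a) = ∑-single′ a

erase : ∀ {k} → Fin k → (Fin k → ℕ) → Fin k → ℕ
erase a f i = if does (i ≟ a) then 0 else f i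

∑-erase : ∀ {k} (a : Fin k) (f : Fin k → ℕ) → ∑ f ≡ f a + ∑ (erase a f)
∑-erase {suc k} zero f = refl
∑-erase {suc k} (suc a) f =
  trans (cong (f zero +_) (∑-erase a (λ i → f (suc i))))
    (trans (sym (+-assoc (f zero) (f (suc a)) R))
      (trans (cong (_+ R) (+-comm (f zero) (f (suc a)))) (+-assoc (f (suc a)) (f zero) R)))
  where R = ∑ (erase a (λ i → f (suc i)))

erase-self : ∀ {k} (a : Fin k) f → erase a f a ≡ 0
erase-self a f with a ≟ a
... | yes _ = refl
... | no a≢a = ⊥-elim (a≢a refl)

erase-other : ∀ {k} (a i : Fin k) f → i ≢ a → erase a f i ≡ f i
erase-other a i f i≢a with i ≟ a
... | yes i≡a = ⊥-elim (i≢a i≡a)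
... | no _ = refl

erase-≢0 : ∀ {k} (a i : Fin k) f → erase a f i ≢ 0 → i ≢ a × f i ≢ 0
erase-≢0 a i f nz with i ≟ a
... | yes _ = ⊥-elim (nz refl)
... | no i≢a = i≢a , nz

∑≢0⇒nonzero : ∀ {k} (f : Fin k → ℕ) → ∑ f ≢ 0 → ∃ λ i → f i ≢ 0
∑≢0⇒nonzero {zero} f h = ⊥-elim (h refl)
∑≢0⇒nonzero {suc k} f h with f zero in fz
... | suc _ = zero , λ z → 0≢1+n (trans (sym z) fz)
... | zero with ∑≢0⇒nonzero (λ i → f (suc i)) h
...   | i , fi≢0 = suc i , fi≢0

nonzero⇒∑≢0 : ∀ {k} (f : Fin k → ℕ) a → f a ≢ 0 → ∑ f ≢ 0
nonzero⇒∑≢0 f a fa≢0 ∑≡0 = fa≢0 (∑≡0⇒zero f ∑≡0 a)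

nonzero-besides : ∀ {k} (f : Fin k → ℕ) a c → ∑ f ≡ f a + suc c → ∃ λ b → b ≢ a × f b ≢ 0
nonzero-besides f a c s with ∑≢0⇒nonzero (erase a f) (λ z → 0≢1+n (trans (sym z) rest))
  where rest : ∑ (erase a f) ≡ suc c
        rest = +-cancelˡ-≡ (f a) _ _ (trans (sym (∑-erase a f)) s)
... | b , nz = b , erase-≢0 a b f nz

Binary : ∀ {k} → (Fin k → ℕ) → Set
Binary f = ∀ i → f i ≤ 1

erase-binary : ∀ {k} (a : Fin k) f → Binary f → Binary (erase a f)
erase-binary a f h i with i ≟ a
... | yes _ = z≤n
... | no _ = h i

≤1⇒≢0⇒≡1 : ∀ {x} → x ≤ 1 → x ≢ 0 → x ≡ 1
≤1⇒≢0⇒≡1 {zero} _ h = ⊥-elim (h refl)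
≤1⇒≢0⇒≡1 {suc zero} _ _ = refl
≤1⇒≢0⇒≡1 {suc (suc _)} (s≤s ()) _

binary-∑-suc : ∀ {k} (f : Fin k → ℕ) (c : ℕ) → Binary f → ∑ f ≡ suc c →
  ∃ λ a → f a ≡ 1 × ∑ (erase a f) ≡ c
binary-∑-suc f c h s with ∑≢0⇒nonzero f (λ z → 0≢1+n (trans (sym z) s))
... | a , nz = a , fa≡1 , cong pred (trans (sym (trans (∑-erase a f) (cong (_+ ∑ (erase a f)) fa≡1))) s)
  where fa≡1 = ≤1⇒≢0⇒≡1 (h a) nz

binary-∑≡1 : ∀ {k} (f : Fin k → ℕ) → Binary f → ∑ f ≡ 1 →
  ∃ λ a → f a ≡ 1 × (∀ i → i ≢ a → f i ≡ 0)
binary-∑≡1 f h s with binary-∑-suc f 0 h s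
... | a , fa , r = a , fa , λ i i≢a → trans (sym (erase-other a i f i≢a)) (∑≡0⇒zero _ r i)

binary-∑≡2 : ∀ {k} (f : Fin k → ℕ) → Binary f → ∑ f ≡ 2 →
  ∃₂ λ a b → a ≢ b × f a ≡ 1 × f b ≡ 1 × (∀ i → i ≢ a → i ≢ b → f i ≡ 0)
binary-∑≡2 f h s with binary-∑-suc f 1 h s
... | a , fa , r with binary-∑≡1 (erase a f) (erase-binary a f h) r
...   | b , rb , rest = a , b , a≢b , fa , trans (sym (erase-other a b f (a≢b ∘ sym))) rb ,
        λ i i≢a i≢b → trans (sym (erase-other a i f i≢a)) (rest i i≢b)
  where
  a≢b : a ≢ b
  a≢b refl = 0≢1+n (trans (sym (erase-self a f)) rb)

binary-∑≡3 : ∀ {k} (f : Fin k → ℕ) → Binary f → ∑ f ≡ 3 →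
  ∃₂ λ a b → ∃ λ c → a ≢ b × a ≢ c × b ≢ c × f a ≡ 1 × f b ≡ 1 × f c ≡ 1 ×
    (∀ i → i ≢ a → i ≢ b → i ≢ c → f i ≡ 0)
binary-∑≡3 f h s with binary-∑-suc f 2 h s
... | a , fa , r with binary-∑≡2 (erase a f) (erase-binary a f h) r
...   | b , c , b≢c , rb , rc , rest =
        a , b , c , a≢ rb , a≢ rc , b≢c , fa ,
        trans (sym (erase-other a b f (a≢ rb ∘ sym))) rb ,
        trans (sym (erase-other a c f (a≢ rc ∘ sym))) rc ,
        λ i i≢a i≢b i≢c → trans (sym (erase-other a i f i≢a)) (rest i i≢b i≢c)
  where
  a≢ : ∀ {x} → erase a f x ≡ 1 → a ≢ x
  a≢ rx refl = 0≢1+n (trans (sym (erase-self a f)) rx)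

≡1⇒≢0 : ∀ {x} → x ≡ 1 → x ≢ 0
≡1⇒≢0 refl ()

Spread3 : ∀ {k} → (Fin k → ℕ) → Set
Spread3 h = (∃₂ λ a b → a ≢ b × h a ≡ 2 × h b ≢ 0)
          ⊎ (∃₂ λ a b → ∃ λ c → a ≢ b × a ≢ c × b ≢ c × h a ≢ 0 × h b ≢ 0 × h c ≢ 0)

∑≡3⇒spread3 : ∀ {k} (h : Fin k → ℕ) → (∀ i → h i ≤ 2) → ∑ h ≡ 3 → Spread3 h
∑≡3⇒spread3 h h≤2 s with ∑≢0⇒nonzero h (λ z → 0≢1+n (trans (sym z) s))
... | a , ha≢0 with h a in ha | h≤2 a
...   | zero | _ = ⊥-elim (ha≢0 refl)
...   | suc (suc (suc _)) | s≤s (s≤s ())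
...   | suc (suc zero) | _ with nonzero-besides h a 0 (trans s (cong (_+ 1) (sym ha)))
...     | b , b≢a , hb≢0 = inj₁ (a , b , b≢a ∘ sym , ha , hb≢0)
∑≡3⇒spread3 h h≤2 s | a , ha≢0 | suc zero | _ with nonzero-besides h a 1 (trans s (cong (_+ 2) (sym ha)))
... | b , b≢a , hb≢0 with h b in hb | h≤2 b
...   | zero | _ = ⊥-elim (hb≢0 refl)
...   | suc (suc (suc _)) | s≤s (s≤s ())
...   | suc (suc zero) | _ = inj₁ (b , a , b≢a , hb , ≡1⇒≢0 ha)
...   | suc zero | _ with nonzero-besides (erase a h) b 0 erased-sum
  where
  erased-sum : ∑ (erase a h) ≡ erase a h b + 1
  erased-sum = trans (+-cancelˡ-≡ 1 _ _ (trans (sym (trans (∑-erase a h) (cong (_+ ∑ (erase a h)) ha))) s))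
                     (cong (_+ 1) (sym (trans (erase-other a b h b≢a) hb)))
...     | c , c≢b , rc≢0 with erase-≢0 a c h rc≢0
...       | c≢a , hc≢0 = inj₂ (a , b , c , b≢a ∘ sym , c≢a ∘ sym , c≢b ∘ sym , ≡1⇒≢0 ha , ≡1⇒≢0 hb , hc≢0)

-- Incidence, darts and stars in loopless multigraphs

mem : ∀ {m} → Subset m → Fin m → Bool
mem X e = lookup X e

∈⇒mem : ∀ {m} {X : Subset m} {e} → e ∈ X → mem X e ≡ true
∈⇒mem = []=⇒lookup

mem⇒∈ : ∀ {m} {X : Subset m} {e} → mem X e ≡ true → e ∈ X
mem⇒∈ {X = X} {e} p = lookup⇒[]= e X p

mem-∩ : ∀ {m} (X Y : Subset m) e → mem (X ∩ Y) e ≡ (mem X e ∧ mem Y e)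
mem-∩ X Y e = lookup-zipWith _∧_ e X Y

mem-∪ : ∀ {m} (X Y : Subset m) e → mem (X ∪ Y) e ≡ (mem X e ∨ mem Y e)
mem-∪ X Y e = lookup-zipWith _∨_ e X Y

mem-∁ : ∀ {m} (X : Subset m) e → mem (∁ X) e ≡ not (mem X e)
mem-∁ X e = lookup-map e not X

mem-⊤ : ∀ {m} e → mem {m} ⊤ e ≡ true
mem-⊤ {m} e = lookup-replicate e true

card≡∑bit : ∀ {m} (X : Subset m) → card X ≡ ∑ (λ e → bit (mem X e))
card≡∑bit [] = refl
card≡∑bit (true ∷ X) = cong suc (card≡∑bit X)
card≡∑bit (false ∷ X) = card≡∑bit X

inc-≢0 : ∀ {p} (a c x : Fin p) → inc (a , c) x ≢ 0 → (a ≡ x) ⊎ (c ≡ x)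
inc-≢0 a c x nz with a ≟ x | c ≟ x
... | yes a≡x | _ = inj₁ a≡x
... | no _ | yes c≡x = inj₂ c≡x
... | no _ | no _ = ⊥-elim (nz refl)

inc-≡2 : ∀ {p} (a c x : Fin p) → inc (a , c) x ≡ 2 → (a ≡ x) × (c ≡ x)
inc-≡2 a c x e with a ≟ x | c ≟ x
... | yes a≡x | yes c≡x = a≡x , c≡x
... | yes _ | no _ = ⊥-elim (1≢2 e)
  where 1≢2 : 1 ≢ 2
        1≢2 ()
... | no _ | yes _ = ⊥-elim (0≢1+n (cong pred e))
... | no _ | no _ = ⊥-elim (0≢1+n e)

inc-≤2 : ∀ {p} (a c x : Fin p) → inc (a , c) x ≤ 2
inc-≤2 a c x with a ≟ x | c ≟ x
... | yes _ | yes _ = s≤s (s≤s z≤n)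
... | yes _ | no _ = s≤s z≤n
... | no _ | yes _ = s≤s z≤n
... | no _ | no _ = z≤n

inc-≡1 : ∀ {p} (a c x : Fin p) → (a ≡ x) ⊎ (c ≡ x) → a ≢ c → inc (a , c) x ≡ 1
inc-≡1 a c x at a≢c with a ≟ x | c ≟ x | at
... | yes a≡x | yes c≡x | _ = ⊥-elim (a≢c (trans a≡x (sym c≡x)))
... | yes _ | no _ | _ = refl
... | no _ | yes _ | _ = refl
... | no a≢x | no _ | inj₁ a≡x = ⊥-elim (a≢x a≡x)
... | no _ | no c≢x | inj₂ c≡x = ⊥-elim (c≢x c≡x)

inc-≡0 : ∀ {p} (a c x : Fin p) → a ≢ x → c ≢ x → inc (a , c) x ≡ 0
inc-≡0 a c x a≢x c≢x with a ≟ x | c ≟ x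
... | yes a≡x | _ = ⊥-elim (a≢x a≡x)
... | no _ | yes c≡x = ⊥-elim (c≢x c≡x)
... | no _ | no _ = refl

∑-inc : ∀ {n} (a b : Fin n) → ∑ (λ v → inc (a , b) v) ≡ 2
∑-inc a b = trans (∑-+ (λ v → indicator (a ≟ v)) (λ v → indicator (b ≟ v)))
  (cong₂ _+_ (∑-single′ a) (∑-single′ b))

handshake : ∀ {n m} (H : Multigraph n m) (X : Subset m) → ∑ (λ v → degree H X v) ≡ card X + card X
handshake {n} H X = trans (∑-swap (λ v e → if mem X e then inc (ends H e) v else 0))
  (trans (∑-cong ends-of) (trans (∑-+ (λ e → bit (mem X e)) (λ e → bit (mem X e)))
    (sym (cong₂ _+_ (card≡∑bit X) (card≡∑bit X)))))
  where
  ends-of : ∀ e → ∑ (λ v → if mem X e then inc (ends H e) v else 0) ≡ bit (mem X e) + bit (mem X e)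
  ends-of e with mem X e
  ... | true = ∑-inc (proj₁ (ends H e)) (proj₂ (ends H e))
  ... | false = ∑-zero {k = n} (λ v → 0) (λ v → refl)

Incident : ∀ {n m} → Multigraph n m → Fin m → Fin n → Set
Incident H e v = (proj₁ (ends H e) ≡ v) ⊎ (proj₂ (ends H e) ≡ v)

-- An edge traversed in one of its two directions.
Dart : ℕ → Set
Dart m = Fin m × Bool

rev : ∀ {m} → Dart m → Dart m
rev (e , b) = e , not b

rev-rev : ∀ {m} (d : Dart m) → rev (rev d) ≡ d
rev-rev (e , b) = cong (e ,_) (not-involutive b)

rev≢ : ∀ {m} (d : Dart m) → rev d ≢ d
rev≢ (e , false) ()
rev≢ (e , true) ()

_≟ᵈ_ : ∀ {m} (d d′ : Dart m) → Dec (d ≡ d′)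
_≟ᵈ_ = ≡-dec _≟_ _≟ᵇ_

same-edge : ∀ {m} (d d′ : Dart m) → proj₁ d ≡ proj₁ d′ → (d ≡ d′) ⊎ (d ≡ rev d′)
same-edge (e , false) (.e , false) refl = inj₁ refl
same-edge (e , false) (.e , true) refl = inj₂ refl
same-edge (e , true) (.e , false) refl = inj₂ refl
same-edge (e , true) (.e , true) refl = inj₁ refl

data OneHot : Bool → Bool → Bool → Set where
  first : OneHot true false false
  second : OneHot false true false
  third : OneHot false false true

module Loopless {n m} (H : Multigraph n m) (loopless : ∀ e → proj₁ (ends H e) ≢ proj₂ (ends H e)) where

  tl : Dart m → Fin n
  tl (e , false) = proj₁ (ends H e)
  tl (e , true) = proj₂ (ends H e)

  hd : Dart m → Fin n
  hd (e , false) = proj₂ (ends H e)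
  hd (e , true) = proj₁ (ends H e)

  tl-rev : ∀ d → tl (rev d) ≡ hd d
  tl-rev (e , false) = refl
  tl-rev (e , true) = refl

  hd-rev : ∀ d → hd (rev d) ≡ tl d
  hd-rev (e , false) = refl
  hd-rev (e , true) = refl

  tl≢hd : ∀ d → tl d ≢ hd d
  tl≢hd (e , false) p = loopless e p
  tl≢hd (e , true) p = loopless e (sym p)

  incident-tl : ∀ d → Incident H (proj₁ d) (tl d)
  incident-tl (e , false) = inj₁ refl
  incident-tl (e , true) = inj₂ refl

  incident-hd : ∀ d → Incident H (proj₁ d) (hd d)
  incident-hd (e , false) = inj₂ refl
  incident-hd (e , true) = inj₁ refl

  dart-joins : ∀ d → Joins H (proj₁ d) (tl d) (hd d)
  dart-joins (e , false) = inj₁ refl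
  dart-joins (e , true) = inj₂ refl

  dart-into : ∀ e v → Incident H e v → ∃ λ b → hd (e , b) ≡ v
  dart-into e v (inj₁ p) = true , p
  dart-into e v (inj₂ p) = false , p

  dartFrom : Fin m → Fin n → Dart m
  dartFrom e v = e , (if does (proj₁ (ends H e) ≟ v) then false else true)

  tl-dartFrom : ∀ e v → Incident H e v → tl (dartFrom e v) ≡ v
  tl-dartFrom e v a with proj₁ (ends H e) ≟ v
  ... | yes p = p
  tl-dartFrom e v (inj₁ p) | no np = ⊥-elim (np p)
  tl-dartFrom e v (inj₂ p) | no np = p

  dartFrom-tl : ∀ d v → tl d ≡ v → dartFrom (proj₁ d) v ≡ d
  dartFrom-tl (e , false) v p with proj₁ (ends H e) ≟ v
  ... | yes _ = refl
  ... | no np = ⊥-elim (np p)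
  dartFrom-tl (e , true) v p with proj₁ (ends H e) ≟ v
  ... | yes q = ⊥-elim (loopless e (trans q (sym p)))
  ... | no _ = refl

  joins-incident : ∀ e u w v → Joins H e u w → Incident H e v → (v ≡ u) ⊎ (v ≡ w)
  joins-incident e u w v (inj₁ p) (inj₁ q) = inj₁ (trans (sym q) (cong proj₁ p))
  joins-incident e u w v (inj₁ p) (inj₂ q) = inj₂ (trans (sym q) (cong proj₂ p))
  joins-incident e u w v (inj₂ p) (inj₁ q) = inj₂ (trans (sym q) (cong proj₁ p))
  joins-incident e u w v (inj₂ p) (inj₂ q) = inj₁ (trans (sym q) (cong proj₂ p))

  joins⇒incident₁ : ∀ e u w → Joins H e u w → Incident H e u
  joins⇒incident₁ e u w (inj₁ p) = inj₁ (cong proj₁ p)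
  joins⇒incident₁ e u w (inj₂ p) = inj₂ (cong proj₂ p)

  joins⇒incident₂ : ∀ e u w → Joins H e u w → Incident H e w
  joins⇒incident₂ e u w (inj₁ p) = inj₂ (cong proj₂ p)
  joins⇒incident₂ e u w (inj₂ p) = inj₁ (cong proj₁ p)

  joins-tl⇒hd : ∀ d u w → Joins H (proj₁ d) u w → tl d ≡ u → hd d ≡ w
  joins-tl⇒hd (e , false) u w (inj₁ p) t = cong proj₂ p
  joins-tl⇒hd (e , false) u w (inj₂ p) t = ⊥-elim (loopless e (trans t (sym (cong proj₂ p))))
  joins-tl⇒hd (e , true) u w (inj₁ p) t = ⊥-elim (loopless e (trans (cong proj₁ p) (sym t)))
  joins-tl⇒hd (e , true) u w (inj₂ p) t = cong proj₁ p

  joins-hd⇒tl : ∀ d u w → Joins H (proj₁ d) u w → hd d ≡ u → tl d ≡ w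
  joins-hd⇒tl (e , b) u w j h = trans (sym (hd-rev (e , b))) (joins-tl⇒hd (rev (e , b)) u w j (trans (tl-rev (e , b)) h))

  joins-loop : ∀ e u → ¬ Joins H e u u
  joins-loop e u (inj₁ p) = loopless e (trans (cong proj₁ p) (sym (cong proj₂ p)))
  joins-loop e u (inj₂ p) = loopless e (trans (cong proj₁ p) (sym (cong proj₂ p)))

  inc-≤1 : ∀ e v → inc (ends H e) v ≤ 1
  inc-≤1 e v with proj₁ (ends H e) ≟ v | proj₂ (ends H e) ≟ v
  ... | yes p | yes q = ⊥-elim (loopless e (trans p (sym q)))
  ... | yes _ | no _ = s≤s z≤n
  ... | no _ | yes _ = s≤s z≤n
  ... | no _ | no _ = z≤n

  incident⇒inc≡1 : ∀ e v → Incident H e v → inc (ends H e) v ≡ 1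
  incident⇒inc≡1 e v a = inc-≡1 _ _ v a (loopless e)

  inc≢0⇒incident : ∀ e v → inc (ends H e) v ≢ 0 → Incident H e v
  inc≢0⇒incident e v = inc-≢0 _ _ v

  ¬incident⇒inc≡0 : ∀ e v → ¬ Incident H e v → inc (ends H e) v ≡ 0
  ¬incident⇒inc≡0 e v ¬a = inc-≡0 _ _ v (¬a ∘ inj₁) (¬a ∘ inj₂)

  degTerm : Subset m → Fin n → Fin m → ℕ
  degTerm X v e = if mem X e then inc (ends H e) v else 0

  degTerm-binary : ∀ X v → Binary (degTerm X v)
  degTerm-binary X v e with mem X e
  ... | true = inc-≤1 e v
  ... | false = z≤n

  degTerm≡1⇒ : ∀ X v e → degTerm X v e ≡ 1 → mem X e ≡ true × Incident H e v
  degTerm≡1⇒ X v e p with mem X e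
  ... | true = refl , inc≢0⇒incident e v (λ z → 0≢1+n (trans (sym z) p))
  ... | false = ⊥-elim (0≢1+n p)

  degTerm-incident : ∀ X v e → mem X e ≡ true → Incident H e v → degTerm X v e ≡ 1
  degTerm-incident X v e p a rewrite p = incident⇒inc≡1 e v a

  degTerm-bit : ∀ X v e → Incident H e v → degTerm X v e ≡ bit (mem X e)
  degTerm-bit X v e a with mem X e
  ... | true = incident⇒inc≡1 e v a
  ... | false = refl

  degTerm≡0⇒ : ∀ X v e → degTerm X v e ≡ 0 → mem X e ≡ true → ¬ Incident H e v
  degTerm≡0⇒ X v e p q a = 0≢1+n (trans (sym p) (degTerm-incident X v e q a))

  incident⇒degree≢0 : ∀ X v e → mem X e ≡ true → Incident H e v → degree H X v ≢ 0
  incident⇒degree≢0 X v e p a = nonzero⇒∑≢0 (degTerm X v) e (λ z → 0≢1+n (trans (sym z) (degTerm-incident X v e p a)))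

  record Star₁ (X : Subset m) (v : Fin n) : Set where
    field
      a : Fin m
      a∈ : mem X a ≡ true
      a-at : Incident H a v
      only : ∀ e → mem X e ≡ true → Incident H e v → e ≡ a

  record Star₂ (X : Subset m) (v : Fin n) : Set where
    field
      a b : Fin m
      a≢b : a ≢ b
      a∈ : mem X a ≡ true
      b∈ : mem X b ≡ true
      a-at : Incident H a v
      b-at : Incident H b v
      only : ∀ e → mem X e ≡ true → Incident H e v → (e ≡ a) ⊎ (e ≡ b)

  record Star₃ (X : Subset m) (v : Fin n) : Set where
    field
      a b c : Fin m
      a≢b : a ≢ b
      a≢c : a ≢ c
      b≢c : b ≢ c
      a∈ : mem X a ≡ true
      b∈ : mem X b ≡ true
      c∈ : mem X c ≡ true
      a-at : Incident H a v
      b-at : Incident H b v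
      c-at : Incident H c v
      only : ∀ e → mem X e ≡ true → Incident H e v → (e ≡ a) ⊎ (e ≡ b) ⊎ (e ≡ c)

  opaque
    star₁ : ∀ X v → degree H X v ≡ 1 → Star₁ X v
    star₁ X v p with binary-∑≡1 (degTerm X v) (degTerm-binary X v) p
    ... | a , ta , rest = record
      { a = a ; a∈ = proj₁ (degTerm≡1⇒ X v a ta) ; a-at = proj₂ (degTerm≡1⇒ X v a ta) ; only = only }
      where
      only : ∀ e → mem X e ≡ true → Incident H e v → e ≡ a
      only e e∈ e-at with e ≟ a
      ... | yes e≡a = e≡a
      ... | no e≢a = ⊥-elim (degTerm≡0⇒ X v e (rest e e≢a) e∈ e-at)

    star₂ : ∀ X v → degree H X v ≡ 2 → Star₂ X v
    star₂ X v p with binary-∑≡2 (degTerm X v) (degTerm-binary X v) p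
    ... | a , b , a≢b , ta , tb , rest = record
      { a = a ; b = b ; a≢b = a≢b
      ; a∈ = proj₁ (degTerm≡1⇒ X v a ta) ; b∈ = proj₁ (degTerm≡1⇒ X v b tb)
      ; a-at = proj₂ (degTerm≡1⇒ X v a ta) ; b-at = proj₂ (degTerm≡1⇒ X v b tb)
      ; only = only }
      where
      only : ∀ e → mem X e ≡ true → Incident H e v → (e ≡ a) ⊎ (e ≡ b)
      only e e∈ e-at with e ≟ a | e ≟ b
      ... | yes e≡a | _ = inj₁ e≡a
      ... | no _ | yes e≡b = inj₂ e≡b
      ... | no e≢a | no e≢b = ⊥-elim (degTerm≡0⇒ X v e (rest e e≢a e≢b) e∈ e-at)

    star₃ : ∀ X v → degree H X v ≡ 3 → Star₃ X v
    star₃ X v p = build (binary-∑≡3 (degTerm X v) (degTerm-binary X v) p)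
      where
      build : (∃₂ λ a b → ∃ λ c → a ≢ b × a ≢ c × b ≢ c × degTerm X v a ≡ 1 × degTerm X v b ≡ 1 ×
                degTerm X v c ≡ 1 × (∀ i → i ≢ a → i ≢ b → i ≢ c → degTerm X v i ≡ 0)) → Star₃ X v
      build (a , b , c , a≢b , a≢c , b≢c , ta , tb , tc , rest) = record
        { a = a ; b = b ; c = c ; a≢b = a≢b ; a≢c = a≢c ; b≢c = b≢c
        ; a∈ = proj₁ (degTerm≡1⇒ X v a ta) ; b∈ = proj₁ (degTerm≡1⇒ X v b tb) ; c∈ = proj₁ (degTerm≡1⇒ X v c tc)
        ; a-at = proj₂ (degTerm≡1⇒ X v a ta) ; b-at = proj₂ (degTerm≡1⇒ X v b tb) ; c-at = proj₂ (degTerm≡1⇒ X v c tc)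
        ; only = only }
        where
        only : ∀ e → mem X e ≡ true → Incident H e v → (e ≡ a) ⊎ (e ≡ b) ⊎ (e ≡ c)
        only e e∈ e-at with e ≟ a | e ≟ b | e ≟ c
        ... | yes e≡a | _ | _ = inj₁ e≡a
        ... | no _ | yes e≡b | _ = inj₂ (inj₁ e≡b)
        ... | no _ | no _ | yes e≡c = inj₂ (inj₂ e≡c)
        ... | no e≢a | no e≢b | no e≢c = ⊥-elim (degTerm≡0⇒ X v e (rest e e≢a e≢b e≢c) e∈ e-at)

  -- Star₃ ⊤ v lists all edges at v, so the degree of v in any subgraph is read off these three edges.
  module _ {v : Fin n} (star : Star₃ ⊤ v) where
    open Star₃ star

    incident-star : ∀ e → Incident H e v → (e ≡ a) ⊎ (e ≡ b) ⊎ (e ≡ c)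
    incident-star e e-at = only e (mem-⊤ e) e-at

    oneHot-star : ∀ X → Star₁ X v → OneHot (mem X a) (mem X b) (mem X c)
    oneHot-star X x = pick (incident-star x₀ x₀-at)
      where
      open Star₁ x renaming (a to x₀; a∈ to x₀∈; a-at to x₀-at; only to only-x₀)
      ∉X : ∀ e → e ≢ x₀ → Incident H e v → mem X e ≡ false
      ∉X e e≢x₀ e-at with mem X e in e∈
      ... | true = ⊥-elim (e≢x₀ (only-x₀ e e∈ e-at))
      ... | false = refl
      pick : (x₀ ≡ a) ⊎ (x₀ ≡ b) ⊎ (x₀ ≡ c) → OneHot (mem X a) (mem X b) (mem X c)
      pick (inj₁ refl) rewrite x₀∈ | ∉X b (a≢b ∘ sym) b-at | ∉X c (a≢c ∘ sym) c-at = first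
      pick (inj₂ (inj₁ refl)) rewrite x₀∈ | ∉X a a≢b a-at | ∉X c (b≢c ∘ sym) c-at = second
      pick (inj₂ (inj₂ refl)) rewrite x₀∈ | ∉X a a≢c a-at | ∉X b b≢c b-at = third

    degTerm-star : ∀ Y e → degTerm Y v e ≡
      (if does (e ≟ a) then bit (mem Y a) else 0) + ((if does (e ≟ b) then bit (mem Y b) else 0)
        + (if does (e ≟ c) then bit (mem Y c) else 0))
    degTerm-star Y e with e ≟ a | e ≟ b | e ≟ c
    ... | yes refl | yes e≡b | _ = ⊥-elim (a≢b e≡b)
    ... | yes refl | _ | yes e≡c = ⊥-elim (a≢c e≡c)
    ... | no _ | yes refl | yes e≡c = ⊥-elim (b≢c e≡c)
    ... | yes refl | no _ | no _ = trans (degTerm-bit Y v e a-at) (sym (+-identityʳ _))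
    ... | no _ | yes refl | no _ = trans (degTerm-bit Y v e b-at) (sym (+-identityʳ _))
    ... | no _ | no _ | yes refl = degTerm-bit Y v e c-at
    ... | no e≢a | no e≢b | no e≢c with mem Y e
    ...   | false = refl
    ...   | true = ¬incident⇒inc≡0 e v λ e-at → [ e≢a , [ e≢b , e≢c ] ] (incident-star e e-at)

    degree-star : ∀ Y → degree H Y v ≡ bit (mem Y a) + (bit (mem Y b) + bit (mem Y c))
    degree-star Y = trans (∑-cong (degTerm-star Y))
      (trans (∑-+ {m} at-a (λ e → at-b e + at-c e)) (cong₂ _+_ (∑-single a (bit (mem Y a)))
        (trans (∑-+ {m} at-b at-c) (cong₂ _+_ (∑-single b (bit (mem Y b))) (∑-single c (bit (mem Y c)))))))
      where
      at-a at-b at-c : Fin m → ℕ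
      at-a e = if does (e ≟ a) then bit (mem Y a) else 0
      at-b e = if does (e ≟ b) then bit (mem Y b) else 0
      at-c e = if does (e ≟ c) then bit (mem Y c) else 0

-- Components, subdivisions and even circuits

module ComponentOf {n m} (H : Multigraph n m) (loopless : ∀ e → proj₁ (ends H e) ≢ proj₂ (ends H e))
  (X : Subset m) (C : Subset n) (comp : IsComponent H X C) where

  open Loopless H loopless
  open IsComponent comp

  F : Subset m
  F = compEdges H X C

  mem-F : ∀ e → mem F e ≡ (mem X e ∧ (mem C (proj₁ (ends H e)) ∧ mem C (proj₂ (ends H e))))
  mem-F e = lookup∘tabulate _ e

  F⇒X : ∀ e → mem F e ≡ true → mem X e ≡ true
  F⇒X e p = ∧-conicalˡ _ _ (trans (sym (mem-F e)) p)

  F-inside : ∀ e v → mem F e ≡ true → Incident H e v → mem C v ≡ true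
  F-inside e v p e-at with ∧-conicalʳ (mem X e) _ (trans (sym (mem-F e)) p)
  ... | ends∈C with e-at
  ...   | inj₁ refl = ∧-conicalˡ _ _ ends∈C
  ...   | inj₂ refl = ∧-conicalʳ _ _ ends∈C

  X-closed : ∀ e u w → mem X e ≡ true → Joins H e u w → mem C u ≡ true → mem C w ≡ true
  X-closed e u w p j q = ∈⇒mem (closed e u w (mem⇒∈ p) j (mem⇒∈ q))

  X⇒F : ∀ e v → mem X e ≡ true → Incident H e v → mem C v ≡ true → mem F e ≡ true
  X⇒F e v p e-at q rewrite mem-F e | p with e-at
  ... | inj₁ refl rewrite q = X-closed e _ _ p (inj₁ refl) q
  ... | inj₂ refl rewrite q | X-closed e _ _ p (inj₂ refl) q = refl

  degTerm-F : ∀ v → mem C v ≡ true → ∀ e → degTerm F v e ≡ degTerm X v e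
  degTerm-F v v∈C e with mem X e in e∈X | mem F e in e∈F
  ... | false | false = refl
  ... | true | true = refl
  ... | false | true = ⊥-elim (false≢true (trans (sym e∈X) (F⇒X e e∈F)))
  ... | true | false with inc (ends H e) v in ie
  ...   | zero = refl
  ...   | suc _ = ⊥-elim (false≢true (trans (sym e∈F)
                    (X⇒F e v e∈X (inc≢0⇒incident e v (λ z → 0≢1+n (trans (sym z) ie))) v∈C)))

  degree-F : ∀ v → mem C v ≡ true → degree H F v ≡ degree H X v
  degree-F v v∈C = ∑-cong (degTerm-F v v∈C)

  degTerm-F-outside : ∀ v → mem C v ≡ false → ∀ e → degTerm F v e ≡ 0
  degTerm-F-outside v v∉C e with mem F e in e∈F
  ... | false = refl
  ... | true with inc (ends H e) v in ie
  ...   | zero = refl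
  ...   | suc _ = ⊥-elim (false≢true (trans (sym v∉C)
                    (F-inside e v e∈F (inc≢0⇒incident e v (λ z → 0≢1+n (trans (sym z) ie))))))

  degree-F-outside : ∀ v → mem C v ≡ false → degree H F v ≡ 0
  degree-F-outside v v∉C = ∑-zero (degTerm F v) (degTerm-F-outside v v∉C)

  reach-F : ∀ u w → Reach H X u w → mem C u ≡ true → Reach H F u w
  reach-F u .u here u∈C = here
  reach-F u w (step {w = x} e e∈X j r) u∈C =
    step e (mem⇒∈ (X⇒F e u (∈⇒mem e∈X) (joins⇒incident₁ e u x j) u∈C)) j
      (reach-F x w r (X-closed e u x (∈⇒mem e∈X) j u∈C))

  connected-F : ∀ u w → mem C u ≡ true → mem C w ≡ true → Reach H F u w
  connected-F u w u∈C w∈C = reach-F u w (connected u w (mem⇒∈ u∈C) (mem⇒∈ w∈C)) u∈C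

last-or-inject₁ : ∀ {k} (j : Fin (suc k)) → (j ≡ fromℕ k) ⊎ (∃ λ j′ → j ≡ inject₁ j′)
last-or-inject₁ {zero} zero = inj₁ refl
last-or-inject₁ {suc k} zero = inj₂ (zero , refl)
last-or-inject₁ {suc k} (suc j) with last-or-inject₁ j
... | inj₁ p = inj₁ (cong suc p)
... | inj₂ (j′ , p) = inj₂ (suc j′ , cong suc p)

three-in-two : ∀ {A : Set} {a b c x y : A} → a ≢ b → a ≢ c → b ≢ c →
  (a ≡ x) ⊎ (a ≡ y) → (b ≡ x) ⊎ (b ≡ y) → (c ≡ x) ⊎ (c ≡ y) → ⊥
three-in-two a≢b a≢c b≢c (inj₁ refl) (inj₁ q) _ = a≢b (sym q)
three-in-two a≢b a≢c b≢c (inj₁ refl) (inj₂ q) (inj₁ r) = a≢c (sym r)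
three-in-two a≢b a≢c b≢c (inj₁ refl) (inj₂ refl) (inj₂ r) = b≢c (sym r)
three-in-two a≢b a≢c b≢c (inj₂ refl) (inj₂ q) _ = a≢b (sym q)
three-in-two a≢b a≢c b≢c (inj₂ refl) (inj₁ q) (inj₂ r) = a≢c (sym r)
three-in-two a≢b a≢c b≢c (inj₂ refl) (inj₁ refl) (inj₁ r) = b≢c (sym r)

module SubdivisionFacts {n m p q} (H : Multigraph n m) (loopless : ∀ e → proj₁ (ends H e) ≢ proj₂ (ends H e))
  {C : Subset n} {F : Subset m} {K : Multigraph p q} (s : Subdivision H C F K) where

  open Loopless H loopless
  open Subdivision s

  pedge∈F : ∀ f i → mem F (pedge f i) ≡ true
  pedge∈F f i = ∈⇒mem (pedge-in f i)

  private
    inner-on-path : ∀ f (i : Fin (len f)) g j →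
      (pvert f (inner i) ≡ pvert g (inject₁ j)) ⊎ (pvert f (inner i) ≡ pvert g (suc j)) →
      (pedge g j ≡ pedge f (inject₁ i)) ⊎ (pedge g j ≡ pedge f (suc i))
    inner-on-path f i g zero (inj₁ w) = ⊥-elim (inner-new f i (proj₁ (ends K g)) (trans w (pvert-start g)))
    inner-on-path f i g (suc j′) (inj₁ w) with inner-unique f i g j′ w
    ... | refl , t = inj₂ (cong (λ z → pedge f (suc z)) (toℕ-injective (sym t)))
    inner-on-path f i g j (inj₂ w) with last-or-inject₁ j
    ... | inj₁ refl = ⊥-elim (inner-new f i (proj₂ (ends K g)) (trans w (pvert-end g)))
    ... | inj₂ (j′ , refl) with inner-unique f i g j′ w
    ...   | refl , t = inj₁ (cong (λ z → pedge f (inject₁ z)) (toℕ-injective (sym t)))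

  edges-at-inner : ∀ e f (i : Fin (len f)) → mem F e ≡ true → Incident H e (pvert f (inner i)) →
    (e ≡ pedge f (inject₁ i)) ⊎ (e ≡ pedge f (suc i))
  edges-at-inner e f i e∈F e-at with pedge-cover e (mem⇒∈ e∈F)
  ... | g , j , refl = inner-on-path f i g j (joins-incident (pedge g j) _ _ _ (pedge-joins g j) e-at)

  inner-degree≢3 : ∀ f (i : Fin (len f)) → degree H F (pvert f (inner i)) ≢ 3
  inner-degree≢3 f i d = three-in-two a≢b a≢c b≢c
      (edges-at-inner a f i a∈ a-at) (edges-at-inner b f i b∈ b-at) (edges-at-inner c f i c∈ c-at)
    where open Star₃ (star₃ F (pvert f (inner i)) d)

  -- Some end of a path edge is an inner vertex, which has degree 2, unless the path is a single edge.
  single-edge-path : ∀ e → mem F e ≡ true → (∀ v → Incident H e v → degree H F v ≡ 3) →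
    ∃ λ f → len f ≡ 0 × pedge f zero ≡ e
  single-edge-path e e∈F deg3 with pedge-cover e (mem⇒∈ e∈F)
  ... | f , zero , refl with last-or-inject₁ {len f} zero
  ...   | inj₁ z = f , trans (sym (toℕ-fromℕ (len f))) (cong toℕ (sym z)) , refl
  ...   | inj₂ (j , z) = ⊥-elim (inner-degree≢3 f j
          (trans (cong (λ x → degree H F (pvert f (suc x))) (sym z))
                 (deg3 _ (joins⇒incident₂ (pedge f zero) _ _ (pedge-joins f zero)))))
  single-edge-path e e∈F deg3 | f , suc i , refl =
    ⊥-elim (inner-degree≢3 f i (deg3 _ (joins⇒incident₁ (pedge f (suc i)) _ _ (pedge-joins f (suc i)))))

  firstEdge lastEdge : Fin q → Fin m
  firstEdge f = pedge f zero
  lastEdge f = pedge f (fromℕ (len f))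

  firstEdge-at : ∀ f x → proj₁ (ends K f) ≡ x → Incident H (firstEdge f) (branch x)
  firstEdge-at f x refl =
    subst (Incident H (firstEdge f)) (pvert-start f) (joins⇒incident₁ (firstEdge f) _ _ (pedge-joins f zero))

  lastEdge-at : ∀ f x → proj₂ (ends K f) ≡ x → Incident H (lastEdge f) (branch x)
  lastEdge-at f x refl =
    subst (Incident H (lastEdge f)) (pvert-end f) (joins⇒incident₂ (lastEdge f) _ _ (pedge-joins f (fromℕ (len f))))

  pedge-≢ : ∀ f i g j → f ≢ g → pedge f i ≢ pedge g j
  pedge-≢ f i g j f≢g e = f≢g (proj₁ (pedge-unique f i g j e))

  firstEdge≢lastEdge : ∀ f x → proj₁ (ends K f) ≡ x → proj₂ (ends K f) ≡ x → firstEdge f ≢ lastEdge f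
  firstEdge≢lastEdge f x s e eq with toℕ-injective {i = zero} {j = fromℕ (len f)} (proj₂ (pedge-unique f zero f (fromℕ (len f)) eq))
  ... | z = joins-loop (lastEdge f) (branch x)
    (subst₂ (Joins H (lastEdge f))
      (trans (cong (λ y → pvert f (inject₁ y)) (sym z)) (trans (pvert-start f) (cong branch s)))
      (trans (pvert-end f) (cong branch e))
      (pedge-joins f (fromℕ (len f))))

  edge-at-branch : ∀ f x → inc (ends K f) x ≢ 0 → ∃ λ i → Incident H (pedge f i) (branch x)
  edge-at-branch f x nz with inc-≢0 (proj₁ (ends K f)) (proj₂ (ends K f)) x nz
  ... | inj₁ e = zero , firstEdge-at f x e
  ... | inj₂ e = fromℕ (len f) , lastEdge-at f x e

  -- Three ends of K-edges at x give three distinct F-edges at branch x.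
  branch-degree≢2 : Cubic K → ∀ x → degree H F (branch x) ≢ 2
  branch-degree≢2 cubicK x d2 =
    spread-contradiction (∑≡3⇒spread3 (λ f → inc (ends K f) x)
      (λ f → inc-≤2 (proj₁ (ends K f)) (proj₂ (ends K f)) x) degree-K)
    where
    open Star₂ (star₂ F (branch x) d2)
    degree-K : ∑ (λ f → inc (ends K f) x) ≡ 3
    degree-K = trans (∑-cong (λ f → cong (λ b → if b then inc (ends K f) x else 0) (sym (mem-⊤ f)))) (cubicK x)
    at-branch : ∀ f i → Incident H (pedge f i) (branch x) → (pedge f i ≡ a) ⊎ (pedge f i ≡ b)
    at-branch f i at = only (pedge f i) (pedge∈F f i) at
    spread-contradiction : Spread3 (λ f → inc (ends K f) x) → ⊥
    spread-contradiction (inj₂ (f₁ , f₂ , f₃ , f₁≢f₂ , f₁≢f₃ , f₂≢f₃ , z₁ , z₂ , z₃)) =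
      let (i₁ , a₁) = edge-at-branch f₁ x z₁ ; (i₂ , a₂) = edge-at-branch f₂ x z₂ ; (i₃ , a₃) = edge-at-branch f₃ x z₃ in
      three-in-two (pedge-≢ f₁ i₁ f₂ i₂ f₁≢f₂) (pedge-≢ f₁ i₁ f₃ i₃ f₁≢f₃) (pedge-≢ f₂ i₂ f₃ i₃ f₂≢f₃)
        (at-branch f₁ i₁ a₁) (at-branch f₂ i₂ a₂) (at-branch f₃ i₃ a₃)
    spread-contradiction (inj₁ (f₁ , f₂ , f₁≢f₂ , t₁ , z₂)) =
      let (s₁ , e₁) = inc-≡2 (proj₁ (ends K f₁)) (proj₂ (ends K f₁)) x t₁
          (i₂ , a₂) = edge-at-branch f₂ x z₂ in
      three-in-two (firstEdge≢lastEdge f₁ x s₁ e₁) (pedge-≢ f₁ zero f₂ i₂ f₁≢f₂) (pedge-≢ f₁ (fromℕ (len f₁)) f₂ i₂ f₁≢f₂)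
        (at-branch f₁ zero (firstEdge-at f₁ x s₁)) (at-branch f₁ (fromℕ (len f₁)) (lastEdge-at f₁ x e₁)) (at-branch f₂ i₂ a₂)

  module _ {f : Fin q} (single : len f ≡ 0) where

    single-edge-joins : Joins H (pedge f zero) (branch (proj₁ (ends K f))) (branch (proj₂ (ends K f)))
    single-edge-joins = subst₂ (Joins H (pedge f zero)) (pvert-start f) end (pedge-joins f zero)
      where
      end : pvert f (suc zero) ≡ branch (proj₂ (ends K f))
      end = trans (cong (pvert f) (toℕ-injective (cong suc (sym (trans (toℕ-fromℕ (len f)) single))))) (pvert-end f)

    single-edge-ends : ∀ x → Incident H (pedge f zero) (branch x) → (proj₁ (ends K f) ≡ x) ⊎ (proj₂ (ends K f) ≡ x)
    single-edge-ends x at with joins-incident _ _ _ (branch x) single-edge-joins at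
    ... | inj₁ e = inj₁ (branch-inj _ _ (sym e))
    ... | inj₂ e = inj₂ (branch-inj _ _ (sym e))

    single-edge-at : ∀ x → (proj₁ (ends K f) ≡ x) ⊎ (proj₂ (ends K f) ≡ x) → Incident H (pedge f zero) (branch x)
    single-edge-at x (inj₁ refl) = joins⇒incident₁ _ _ _ single-edge-joins
    single-edge-at x (inj₂ refl) = joins⇒incident₂ _ _ _ single-edge-joins

    single-edge-loopless : proj₁ (ends K f) ≢ proj₂ (ends K f)
    single-edge-loopless e = joins-loop _ _
      (subst (λ y → Joins H (pedge f zero) (branch (proj₁ (ends K f))) (branch y)) (sym e) single-edge-joins)

double-injective : ∀ a b → a + a ≡ b + b → a ≡ b
double-injective zero zero _ = refl
double-injective (suc a) (suc b) e =
  cong suc (double-injective a b (cong pred (trans (sym (+-suc a a)) (trans (cong pred e) (+-suc b b)))))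

-- Both sides of the handshake lemma count |C|: twice for F, once for M.
2∣card-of-2-regular-with-perfect-matching : ∀ {n m} (H : Multigraph n m) (C : Subset n) (F M : Subset m) →
  (∀ v → degree H F v ≡ bit (mem C v) + bit (mem C v)) → (∀ v → degree H M v ≡ bit (mem C v)) → 2 ∣ card F
2∣card-of-2-regular-with-perfect-matching H C F M degF degM = divides (card M) (trans F≡M+M (sym M*2≡M+M))
  where
  |C| = ∑ (λ v → bit (mem C v))
  F+F≡C+C : card F + card F ≡ |C| + |C|
  F+F≡C+C = trans (sym (handshake H F)) (trans (∑-cong degF) (∑-+ (λ v → bit (mem C v)) (λ v → bit (mem C v))))
  M+M≡C : card M + card M ≡ |C|
  M+M≡C = trans (sym (handshake H M)) (∑-cong degM)
  F≡M+M : card F ≡ card M + card M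
  F≡M+M = double-injective _ _ (trans F+F≡C+C (cong (λ z → z + z) (sym M+M≡C)))
  M*2≡M+M : card M * 2 ≡ card M + card M
  M*2≡M+M = trans (*-comm (card M) 2) (cong (card M +_) (+-identityʳ (card M)))

evenCircuit : ∀ {n m} (H : Multigraph n m) (C : Subset n) (F M : Subset m) → (∃ λ v → v ∈ C) →
  (∀ v → mem C v ≡ true → degree H F v ≡ 2) → (∀ v → mem C v ≡ false → degree H F v ≡ 0) →
  (∀ u v → mem C u ≡ true → mem C v ≡ true → Reach H F u v) →
  (∀ v → degree H M v ≡ bit (mem C v)) → IsEvenCircuit H C F
evenCircuit H C F M nonempty inside outside connected degM = record
  { nonempty = nonempty
  ; regular2 = λ v v∈C → inside v (∈⇒mem v∈C)
  ; connected = λ u v u∈C v∈C → connected u v (∈⇒mem u∈C) (∈⇒mem v∈C)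
  ; evenLen = 2∣card-of-2-regular-with-perfect-matching H C F M degF degM }
  where
  degF : ∀ v → degree H F v ≡ bit (mem C v) + bit (mem C v)
  degF v with mem C v in v∈C
  ... | true = inside v v∈C
  ... | false = outside v v∈C

-- Bounded search, enumeration and coding of darts

does-true : ∀ {A : Set} (d : Dec A) → does d ≡ true → A
does-true (yes a) _ = a

does-false : ∀ {A : Set} (d : Dec A) → does d ≡ false → ¬ A
does-false (no ¬a) _ = ¬a

does-yes : ∀ {A : Set} (d : Dec A) → A → does d ≡ true
does-yes (yes _) _ = refl
does-yes (no ¬a) a = ⊥-elim (¬a a)

opposite : ∀ {m} → Fin m → Fin m → Fin m → Fin m
opposite a b e = if does (e ≟ a) then b else a

opposite-a : ∀ {m} (a b e : Fin m) → e ≡ a → opposite a b e ≡ b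
opposite-a a b e e≡a with e ≟ a
... | yes _ = refl
... | no e≢a = ⊥-elim (e≢a e≡a)

opposite-b : ∀ {m} (a b e : Fin m) → e ≡ b → a ≢ b → opposite a b e ≡ a
opposite-b a b e e≡b a≢b with e ≟ a
... | yes e≡a = ⊥-elim (a≢b (trans (sym e≡a) e≡b))
... | no _ = refl

<⇒+suc : ∀ i k → i < k → ∃ λ j → i + suc j ≡ k
<⇒+suc zero (suc k) _ = k , refl
<⇒+suc (suc i) (suc k) (s≤s i<k) with <⇒+suc i k i<k
... | j , e = j , cong suc e

+≡⇒≤ : ∀ a b c → a + b ≡ c → a ≤ c
+≡⇒≤ a b c e = subst (a ≤_) e (m≤m+n a b)

-- Bounded minimisation: the least i ≤ N with P i, or N if there is none.
μ : (ℕ → Bool) → ℕ → ℕ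
μ P zero = 0
μ P (suc N) = if P 0 then 0 else suc (μ (λ i → P (suc i)) N)

μ-≤ : ∀ (P : ℕ → Bool) N → μ P N ≤ N
μ-≤ P zero = z≤n
μ-≤ P (suc N) with P 0
... | true = z≤n
... | false = s≤s (μ-≤ (λ i → P (suc i)) N)

μ-false : ∀ (P : ℕ → Bool) N i → i < μ P N → P i ≡ false
μ-false P (suc N) i i<μ with P 0 in p0
μ-false P (suc N) i () | true
μ-false P (suc N) zero i<μ | false = p0
μ-false P (suc N) (suc i) (s≤s i<μ) | false = μ-false (λ i → P (suc i)) N i i<μ

μ-true : ∀ (P : ℕ → Bool) N k → k ≤ N → P k ≡ true → P (μ P N) ≡ true
μ-true P zero zero _ pk = pk
μ-true P (suc N) k k≤N pk with P 0 in p0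
μ-true P (suc N) k k≤N pk | true = p0
μ-true P (suc N) zero k≤N pk | false = ⊥-elim (false≢true (trans (sym p0) pk))
μ-true P (suc N) (suc k) (s≤s k≤N) pk | false = μ-true (λ i → P (suc i)) N k k≤N pk

μ-≥ : ∀ (P : ℕ → Bool) N k → k ≤ N → (∀ i → i < k → P i ≡ false) → k ≤ μ P N
μ-≥ P zero zero _ _ = z≤n
μ-≥ P (suc N) zero _ _ = z≤n
μ-≥ P (suc N) (suc k) (s≤s k≤N) h with P 0 in p0
... | true = ⊥-elim (false≢true (trans (sym (h 0 (s≤s z≤n))) p0))
... | false = s≤s (μ-≥ (λ i → P (suc i)) N k k≤N (λ i i<k → h (suc i) (s≤s i<k)))

μ-exact : ∀ (P : ℕ → Bool) N k → k ≤ N → P k ≡ true → (∀ i → i < k → P i ≡ false) → μ P N ≡ k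
μ-exact P N k k≤N pk h with m≤n⇒m<n∨m≡n (μ-≥ P N k k≤N h)
... | inj₂ e = sym e
... | inj₁ k<μ = ⊥-elim (false≢true (trans (sym (μ-false P N k k<μ)) pk))

record Enumeration {N : ℕ} (P : Fin N → Bool) : Set where
  field
    size : ℕ
    elem : Fin size → Fin N
    elem-injective : ∀ i j → elem i ≡ elem j → i ≡ j
    elem-P : ∀ i → P (elem i) ≡ true
    elem-surjective : ∀ x → P x ≡ true → ∃ λ i → elem i ≡ x

enumerate : ∀ {N} (P : Fin N → Bool) → Enumeration P
enumerate {zero} P = record { size = 0 ; elem = λ () ; elem-injective = λ () ; elem-P = λ () ; elem-surjective = λ () }
enumerate {suc N} P with enumerate (λ x → P (suc x)) | P zero in p0
... | E | true = record
  { size = suc size ; elem = elem′ ; elem-injective = injective ; elem-P = elem′-P ; elem-surjective = surjective }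
  where
  open Enumeration E
  elem′ : Fin (suc size) → Fin (suc N)
  elem′ zero = zero
  elem′ (suc i) = suc (elem i)
  injective : ∀ i j → elem′ i ≡ elem′ j → i ≡ j
  injective zero zero _ = refl
  injective (suc i) (suc j) e = cong suc (elem-injective i j (suc-injective e))
  elem′-P : ∀ i → P (elem′ i) ≡ true
  elem′-P zero = p0
  elem′-P (suc i) = elem-P i
  surjective : ∀ x → P x ≡ true → ∃ λ i → elem′ i ≡ x
  surjective zero _ = zero , refl
  surjective (suc x) px with elem-surjective x px
  ... | i , e = suc i , cong suc e
... | E | false = record
  { size = size ; elem = suc ∘ elem ; elem-injective = λ i j e → elem-injective i j (suc-injective e)
  ; elem-P = elem-P ; elem-surjective = surjective }
  where
  open Enumeration E
  surjective : ∀ x → P x ≡ true → ∃ λ i → suc (elem i) ≡ x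
  surjective zero px = ⊥-elim (false≢true (trans (sym p0) px))
  surjective (suc x) px with elem-surjective x px
  ... | i , e = i , cong suc e

code : ∀ {m} → Dart m → Fin (m + m)
code {m} (e , false) = join m m (inj₁ e)
code {m} (e , true) = join m m (inj₂ e)

decode : ∀ {m} → Fin (m + m) → Dart m
decode {m} x = fromSum (splitAt m x)
  where
  fromSum : Fin m ⊎ Fin m → Dart m
  fromSum (inj₁ e) = e , false
  fromSum (inj₂ e) = e , true

decode-code : ∀ {m} (d : Dart m) → decode (code d) ≡ d
decode-code {m} (e , false) rewrite splitAt-join m m (inj₁ e) = refl
decode-code {m} (e , true) rewrite splitAt-join m m (inj₂ e) = refl

code-decode : ∀ {m} (x : Fin (m + m)) → code {m} (decode {m} x) ≡ x
code-decode {m} x with splitAt m x in sx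
... | inj₁ e = trans (cong (join m m) (sym sx)) (join-splitAt m m x)
... | inj₂ e = trans (cong (join m m) (sym sx)) (join-splitAt m m x)

code-injective : ∀ {m} (d d′ : Dart m) → code d ≡ code d′ → d ≡ d′
code-injective {m} d d′ e = trans (sym (decode-code d)) (trans (cong (decode {m}) e) (decode-code d′))

decode-injective : ∀ {m} (x y : Fin (m + m)) → decode {m} x ≡ decode {m} y → x ≡ y
decode-injective {m} x y e = trans (sym (code-decode {m} x)) (trans (cong (code {m}) e) (code-decode {m} y))

-- Suppressing the vertices of degree 2

-- A thread is the walk that leaves a dart's head along its other edge for as long as that head has degree 2.
module Threads {n m} (H : Multigraph n m) (loopless : ∀ e → proj₁ (ends H e) ≢ proj₂ (ends H e))
  (F : Subset m) (C : Subset n)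
  (F-inside : ∀ e v → mem F e ≡ true → Incident H e v → mem C v ≡ true)
  (degree-2-or-3 : ∀ v → mem C v ≡ true → (degree H F v ≡ 2) ⊎ (degree H F v ≡ 3))
  (connected : ∀ u v → mem C u ≡ true → mem C v ≡ true → Reach H F u v)
  (v₃ : Fin n) (v₃∈C : mem C v₃ ≡ true) (v₃-deg3 : degree H F v₃ ≡ 3) where

  open Loopless H loopless public

  isDeg2 isDeg3 : Fin n → Bool
  isDeg2 v = does (degree H F v ≟ℕ 2)
  isDeg3 v = does (degree H F v ≟ℕ 3)

  isDeg2⇒ : ∀ v → isDeg2 v ≡ true → degree H F v ≡ 2
  isDeg2⇒ v = does-true (degree H F v ≟ℕ 2)

  isDeg3⇒ : ∀ v → isDeg3 v ≡ true → degree H F v ≡ 3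
  isDeg3⇒ v = does-true (degree H F v ≟ℕ 3)

  ⇒isDeg3 : ∀ v → degree H F v ≡ 3 → isDeg3 v ≡ true
  ⇒isDeg3 v = does-yes (degree H F v ≟ℕ 3)

  ¬isDeg2∧isDeg3 : ∀ v → isDeg2 v ≡ true → isDeg3 v ≡ true → ⊥
  ¬isDeg2∧isDeg3 v d2 d3 with trans (sym (isDeg2⇒ v d2)) (isDeg3⇒ v d3)
  ... | ()

  ¬isDeg3⇒isDeg2 : ∀ v → mem C v ≡ true → isDeg3 v ≡ false → isDeg2 v ≡ true
  ¬isDeg3⇒isDeg2 v v∈C ¬d3 with degree-2-or-3 v v∈C
  ... | inj₁ d2 = does-yes (degree H F v ≟ℕ 2) d2
  ... | inj₂ d3 = ⊥-elim (does-false (degree H F v ≟ℕ 3) ¬d3 d3)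

  isDeg2⇒¬isDeg3 : ∀ v → isDeg2 v ≡ true → isDeg3 v ≡ false
  isDeg2⇒¬isDeg3 v d2 with isDeg3 v in d3
  ... | true = ⊥-elim (¬isDeg2∧isDeg3 v d2 d3)
  ... | false = refl

  InF : Dart m → Set
  InF d = mem F (proj₁ d) ≡ true

  hd∈C : ∀ d → InF d → mem C (hd d) ≡ true
  hd∈C d d∈F = F-inside (proj₁ d) (hd d) d∈F (incident-hd d)

  otherEdgeD : ∀ v → Fin m → Dec (degree H F v ≡ 2) → Fin m
  otherEdgeD v e (yes d2) = opposite (Star₂.a (star₂ F v d2)) (Star₂.b (star₂ F v d2)) e
  otherEdgeD v e (no _) = e

  otherEdge : Fin n → Fin m → Fin m
  otherEdge v e = otherEdgeD v e (degree H F v ≟ℕ 2)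

  record OtherEdge (v : Fin n) (e o oo : Fin m) : Set where
    field
      o∈F : mem F o ≡ true
      o-at : Incident H o v
      o≢e : o ≢ e
      oo≡e : oo ≡ e
      only : ∀ e′ → mem F e′ ≡ true → Incident H e′ v → (e′ ≡ e) ⊎ (e′ ≡ o)

  otherEdgeD-spec : ∀ v e (d2? : Dec (degree H F v ≡ 2)) → degree H F v ≡ 2 → mem F e ≡ true → Incident H e v →
    OtherEdge v e (otherEdgeD v e d2?) (otherEdgeD v (otherEdgeD v e d2?) d2?)
  otherEdgeD-spec v e (no ¬d2) d2 _ _ = ⊥-elim (¬d2 d2)
  otherEdgeD-spec v e (yes d2) _ e∈F e-at with Star₂.only (star₂ F v d2) e e∈F e-at
  ... | inj₁ e≡a = record
    { o∈F = subst (λ z → mem F z ≡ true) (sym (opposite-a a b e e≡a)) b∈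
    ; o-at = subst (λ z → Incident H z v) (sym (opposite-a a b e e≡a)) b-at
    ; o≢e = λ z → a≢b (trans (sym e≡a) (trans (sym z) (opposite-a a b e e≡a)))
    ; oo≡e = trans (cong (opposite a b) (opposite-a a b e e≡a)) (trans (opposite-b a b b refl a≢b) (sym e≡a))
    ; only = λ e′ e′∈F e′-at → [ (λ q → inj₁ (trans q (sym e≡a))) , (λ q → inj₂ (trans q (sym (opposite-a a b e e≡a)))) ]
                                 (only e′ e′∈F e′-at) }
    where open Star₂ (star₂ F v d2)
  ... | inj₂ e≡b = record
    { o∈F = subst (λ z → mem F z ≡ true) (sym (opposite-b a b e e≡b a≢b)) a∈
    ; o-at = subst (λ z → Incident H z v) (sym (opposite-b a b e e≡b a≢b)) a-at
    ; o≢e = λ z → a≢b (trans (sym (trans (sym z) (opposite-b a b e e≡b a≢b))) e≡b)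
    ; oo≡e = trans (cong (opposite a b) (opposite-b a b e e≡b a≢b)) (trans (opposite-a a b a refl) (sym e≡b))
    ; only = λ e′ e′∈F e′-at → [ (λ q → inj₂ (trans q (sym (opposite-b a b e e≡b a≢b)))) , (λ q → inj₁ (trans q (sym e≡b))) ]
                                 (only e′ e′∈F e′-at) }
    where open Star₂ (star₂ F v d2)

  otherEdge-spec : ∀ v e → degree H F v ≡ 2 → mem F e ≡ true → Incident H e v →
    OtherEdge v e (otherEdge v e) (otherEdge v (otherEdge v e))
  otherEdge-spec v e = otherEdgeD-spec v e (degree H F v ≟ℕ 2)

  next : Dart m → Dart m
  next d = dartFrom (otherEdge (hd d) (proj₁ d)) (hd d)

  module _ (d : Dart m) (d∈F : InF d) (d2 : isDeg2 (hd d) ≡ true) where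
    private
      v = hd d
    open OtherEdge (otherEdge-spec v (proj₁ d) (isDeg2⇒ v d2) d∈F (incident-hd d))

    next-InF : InF (next d)
    next-InF = o∈F

    tl-next : tl (next d) ≡ hd d
    tl-next = tl-dartFrom _ _ o-at

    next-edge≢ : proj₁ (next d) ≢ proj₁ d
    next-edge≢ = o≢e

    next-rev : next (rev (next d)) ≡ rev d
    next-rev = trans (cong (λ h → dartFrom (otherEdge h (proj₁ (next d))) h) (trans (hd-rev (next d)) tl-next))
      (trans (cong (λ z → dartFrom z v) oo≡e) (dartFrom-tl (rev d) v (tl-rev d)))

    darts-from-deg2 : ∀ x → InF x → tl x ≡ hd d → (x ≡ next d) ⊎ (x ≡ rev d)
    darts-from-deg2 x x∈F tx with only (proj₁ x) x∈F (subst (Incident H (proj₁ x)) tx (incident-tl x))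
    ... | inj₁ e = inj₂ (trans (sym (dartFrom-tl x v tx)) (trans (cong (λ z → dartFrom z v) e) (dartFrom-tl (rev d) v (tl-rev d))))
    ... | inj₂ e = inj₁ (trans (sym (dartFrom-tl x v tx)) (cong (λ z → dartFrom z v) e))

    orbit-step : ∀ e w → mem F e ≡ true → Joins H e v w → (e ≡ proj₁ d) ⊎ (e ≡ proj₁ (next d))
    orbit-step e w e∈F j = only e e∈F (joins⇒incident₁ e v w j)

  next-injective : ∀ d d′ → InF d → InF d′ → isDeg2 (hd d) ≡ true → isDeg2 (hd d′) ≡ true → next d ≡ next d′ → d ≡ d′
  next-injective d d′ d∈F d′∈F d2 d′2 eq =
    [ id , (λ d≡rev → ⊥-elim (tl≢hd d′ (trans (sym (trans (cong hd d≡rev) (hd-rev d′))) hd≡))) ] (same-edge d d′ same)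
    where
    hd≡ : hd d ≡ hd d′
    hd≡ = trans (sym (tl-next d d∈F d2)) (trans (cong tl eq) (tl-next d′ d′∈F d′2))
    same : proj₁ d ≡ proj₁ d′
    same = trans (sym (OtherEdge.oo≡e (otherEdge-spec (hd d) (proj₁ d) (isDeg2⇒ _ d2) d∈F (incident-hd d))))
      (trans (cong₂ otherEdge hd≡ (cong proj₁ eq))
        (OtherEdge.oo≡e (otherEdge-spec (hd d′) (proj₁ d′) (isDeg2⇒ _ d′2) d′∈F (incident-hd d′))))

  advance : Dart m → Dart m
  advance d = if isDeg2 (hd d) then next d else d

  walk : ℕ → Dart m → Dart m
  walk zero d = d
  walk (suc k) d = advance (walk k d)

  walk-+ : ∀ i j d → walk (i + j) d ≡ walk i (walk j d)
  walk-+ zero j d = refl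
  walk-+ (suc i) j d = cong advance (walk-+ i j d)

  advance-InF : ∀ d → InF d → InF (advance d)
  advance-InF d d∈F = by-case (isDeg2 (hd d)) refl
    where
    by-case : ∀ b → isDeg2 (hd d) ≡ b → InF (if b then next d else d)
    by-case true d2 = next-InF d d∈F d2
    by-case false _ = d∈F

  walk-InF : ∀ k d → InF d → InF (walk k d)
  walk-InF zero d d∈F = d∈F
  walk-InF (suc k) d d∈F = advance-InF (walk k d) (walk-InF k d d∈F)

  advance-deg2 : ∀ d → isDeg2 (hd d) ≡ true → advance d ≡ next d
  advance-deg2 d d2 = cong (λ b → if b then next d else d) d2

  walk-suc : ∀ k d → isDeg2 (hd (walk k d)) ≡ true → walk (suc k) d ≡ next (walk k d)
  walk-suc k d = advance-deg2 (walk k d)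

  tl-walk-suc : ∀ k d → InF d → isDeg2 (hd (walk k d)) ≡ true → tl (walk (suc k) d) ≡ hd (walk k d)
  tl-walk-suc k d d∈F d2 = trans (cong tl (walk-suc k d d2)) (tl-next (walk k d) (walk-InF k d d∈F) d2)

  -- The number of darts, which bounds the length of any thread.
  N : ℕ
  N = m + m

  -- A thread with only degree-2 heads is periodic; its heads are then closed under F-edges,
  -- so by connectivity they include v₃, which has degree 3.
  module NeverDeg3 (a : Dart m) (a∈F : InF a) (allDeg2 : ∀ j → j ≤ N → isDeg2 (hd (walk j a)) ≡ true) where

    back : ∀ i j → walk i a ≡ walk (i + j) a → i + j ≤ N → a ≡ walk j a
    back zero j e _ = e
    back (suc i) j e i+j<N = back i j
      (next-injective (walk i a) (walk (i + j) a) (walk-InF i a a∈F) (walk-InF (i + j) a a∈F) deg2-i deg2-i+j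
        (trans (sym (walk-suc i a deg2-i)) (trans e (walk-suc (i + j) a deg2-i+j))))
      (<⇒≤ i+j<N)
      where
      deg2-i = allDeg2 i (≤-trans (m≤m+n i j) (<⇒≤ i+j<N))
      deg2-i+j = allDeg2 (i + j) (<⇒≤ i+j<N)

    repeat : ∃₂ λ (i j : Fin (suc N)) → toℕ i < toℕ j × walk (toℕ i) a ≡ walk (toℕ j) a
    repeat with pigeonhole (≤-refl {suc N}) (λ (i : Fin (suc N)) → code (walk (toℕ i) a))
    ... | i , j , i<j , codes≡ = i , j , i<j , code-injective _ _ codes≡

    periodic : ∃ λ p → suc p ≤ N × a ≡ walk (suc p) a
    periodic with repeat
    ... | i , j , i<j , same with <⇒+suc (toℕ i) (toℕ j) i<j
    ...   | p , i+p≡j = p , ≤-trans (m≤n+m (suc p) (toℕ i)) j≤N , back (toℕ i) (suc p) (trans same (cong (λ z → walk z a) (sym i+p≡j))) j≤N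
      where j≤N = subst (_≤ N) (sym i+p≡j) (≤-pred (toℕ<n j))

    period-1 : ℕ
    period-1 = proj₁ periodic

    period≤N : suc period-1 ≤ N
    period≤N = proj₁ (proj₂ periodic)

    period : a ≡ walk (suc period-1) a
    period = proj₂ (proj₂ periodic)

    reduce : ∀ k → ∃ λ r → r < suc period-1 × walk k a ≡ walk r a
    reduce zero = 0 , s≤s z≤n , refl
    reduce (suc k) with reduce k
    ... | r , r<p , e with m≤n⇒m<n∨m≡n r<p
    ...   | inj₁ r+1<p = suc r , r+1<p , cong advance e
    ...   | inj₂ r+1≡p = 0 , s≤s z≤n , trans (cong advance e) (trans (cong (λ z → walk z a) r+1≡p) (sym period))

    everywhereDeg2 : ∀ k → isDeg2 (hd (walk k a)) ≡ true
    everywhereDeg2 k with reduce k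
    ... | r , r<p , e = trans (cong (λ x → isDeg2 (hd x)) e) (allDeg2 r (≤-trans (<⇒≤ r<p) period≤N))

    OnOrbit : Fin n → Set
    OnOrbit u = ∃ λ k → hd (walk k a) ≡ u

    orbit-closed : ∀ u w e → mem F e ≡ true → Joins H e u w → OnOrbit u → OnOrbit w
    orbit-closed u w e e∈F j (k , hk) with orbit-step x x∈F d2 e w e∈F (subst (λ z → Joins H e z w) (sym hk) j)
      where
      x = walk k a
      x∈F = walk-InF k a a∈F
      d2 = everywhereDeg2 k
    ... | inj₂ refl = suc k , trans (cong hd (walk-suc k a (everywhereDeg2 k)))
          (joins-tl⇒hd (next (walk k a)) u w j (trans (tl-next (walk k a) (walk-InF k a a∈F) (everywhereDeg2 k)) hk))
    ... | inj₁ refl = k + period-1 , trans (sym (tl-walk-suc (k + period-1) a a∈F (everywhereDeg2 (k + period-1))))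
          (trans (cong tl (sym (trans (sym (walk-+ k (suc period-1) a)) (cong (λ z → walk z a) (+-suc k period-1)))))
            (trans (cong (λ z → tl (walk k z)) (sym period)) (joins-hd⇒tl (walk k a) u w j hk)))

    reach-orbit : ∀ u w → Reach H F u w → OnOrbit u → OnOrbit w
    reach-orbit u .u here o = o
    reach-orbit u w (step {w = x} e e∈F j r) o = reach-orbit x w r (orbit-closed u x e (∈⇒mem e∈F) j o)

    impossible : ⊥
    impossible with reach-orbit (hd a) v₃ (connected (hd a) v₃ (hd∈C a a∈F) v₃∈C) (0 , refl)
    ... | k , hk = ¬isDeg2∧isDeg3 v₃ (subst (λ z → isDeg2 z ≡ true) hk (everywhereDeg2 k)) (⇒isDeg3 v₃ v₃-deg3)

  hitsDeg3 : Dart m → ℕ → Bool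
  hitsDeg3 a j = isDeg3 (hd (walk j a))

  terminates : ∀ a → InF a → ∃ λ k → k ≤ N × hitsDeg3 a k ≡ true
  terminates a a∈F with hitsDeg3 a (μ (hitsDeg3 a) N) in hit
  ... | true = μ (hitsDeg3 a) N , μ-≤ (hitsDeg3 a) N , hit
  ... | false = ⊥-elim (NeverDeg3.impossible a a∈F allDeg2)
    where
    allDeg2 : ∀ j → j ≤ N → isDeg2 (hd (walk j a)) ≡ true
    allDeg2 j j≤N with hitsDeg3 a j in hit-j
    ... | true = ⊥-elim (false≢true (trans (sym hit) (μ-true (hitsDeg3 a) N j j≤N hit-j)))
    ... | false = ¬isDeg3⇒isDeg2 _ (hd∈C (walk j a) (walk-InF j a a∈F)) hit-j

  ℓ : Dart m → ℕ
  ℓ a = μ (hitsDeg3 a) N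

  ℓ-≤ : ∀ a → ℓ a ≤ N
  ℓ-≤ a = μ-≤ (hitsDeg3 a) N

  ℓ-deg3 : ∀ a → InF a → isDeg3 (hd (walk (ℓ a) a)) ≡ true
  ℓ-deg3 a a∈F with terminates a a∈F
  ... | k , k≤N , hit = μ-true (hitsDeg3 a) N k k≤N hit

  ℓ-deg2 : ∀ a → InF a → ∀ i → i < ℓ a → isDeg2 (hd (walk i a)) ≡ true
  ℓ-deg2 a a∈F i i<ℓ = ¬isDeg3⇒isDeg2 _ (hd∈C (walk i a) (walk-InF i a a∈F)) (μ-false (hitsDeg3 a) N i i<ℓ)

  hd-rev-walk-suc : ∀ j a → InF a → isDeg2 (hd (walk j a)) ≡ true → hd (rev (walk (suc j) a)) ≡ hd (walk j a)
  hd-rev-walk-suc j a a∈F d2 = trans (hd-rev (walk (suc j) a)) (tl-walk-suc j a a∈F d2)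

  walk-rev : ∀ a → InF a → ∀ k → (∀ i → i < k → isDeg2 (hd (walk i a)) ≡ true) →
    ∀ i j → i + j ≡ k → walk i (rev (walk k a)) ≡ rev (walk j a)
  walk-rev a a∈F k deg2 zero j e = cong (λ z → rev (walk z a)) (sym e)
  walk-rev a a∈F k deg2 (suc i) j e = begin
    advance (walk i (rev (walk k a)))   ≡⟨ cong advance (walk-rev a a∈F k deg2 i (suc j) i+j+1≡k) ⟩
    advance (rev (walk (suc j) a))      ≡⟨ advance-deg2 _ (trans (cong isDeg2 (hd-rev-walk-suc j a a∈F d2)) d2) ⟩
    next (rev (walk (suc j) a))         ≡⟨ cong (λ z → next (rev z)) (walk-suc j a d2) ⟩
    next (rev (next (walk j a)))        ≡⟨ next-rev (walk j a) (walk-InF j a a∈F) d2 ⟩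
    rev (walk j a)                      ∎
    where
    open ≡-Reasoning
    i+j+1≡k : i + suc j ≡ k
    i+j+1≡k = trans (+-suc i j) e
    d2 = deg2 j (+≡⇒≤ (suc j) i k (trans (+-comm (suc j) i) i+j+1≡k))

  walk-rev-¬hitsDeg3 : ∀ a → InF a → ∀ k → (∀ i → i < k → isDeg2 (hd (walk i a)) ≡ true) →
    ∀ i → i < k → hitsDeg3 (rev (walk k a)) i ≡ false
  walk-rev-¬hitsDeg3 a a∈F k deg2 i i<k with <⇒+suc i k i<k
  ... | j , i+j+1≡k = trans (cong (λ z → isDeg3 (hd z)) (walk-rev a a∈F k deg2 i (suc j) i+j+1≡k))
      (trans (cong isDeg3 (hd-rev-walk-suc j a a∈F d2)) (isDeg2⇒¬isDeg3 _ d2))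
    where d2 = deg2 j (+≡⇒≤ (suc j) i k (trans (+-comm (suc j) i) i+j+1≡k))

  -- The possible first darts of threads.
  Start : Dart m → Set
  Start d = InF d × isDeg3 (tl d) ≡ true

  -- The same thread traversed backwards.
  ρ : Dart m → Dart m
  ρ d = rev (walk (ℓ d) d)

  module Started (d : Dart m) (d-start : Start d) where
    private
      d∈F = proj₁ d-start

    walk-ρ : ∀ i j → i + j ≡ ℓ d → walk i (ρ d) ≡ rev (walk j d)
    walk-ρ = walk-rev d d∈F (ℓ d) (ℓ-deg2 d d∈F)

    ρ-Start : Start (ρ d)
    ρ-Start = walk-InF (ℓ d) d d∈F , trans (cong isDeg3 (tl-rev (walk (ℓ d) d))) (ℓ-deg3 d d∈F)

    ℓ-ρ : ℓ (ρ d) ≡ ℓ d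
    ℓ-ρ = μ-exact (hitsDeg3 (ρ d)) N (ℓ d) (ℓ-≤ d)
      (trans (cong (λ z → isDeg3 (hd z)) (walk-ρ (ℓ d) 0 (+-identityʳ _))) (trans (cong isDeg3 (hd-rev d)) (proj₂ d-start)))
      (walk-rev-¬hitsDeg3 d d∈F (ℓ d) (ℓ-deg2 d d∈F))

    ρ-ρ : ρ (ρ d) ≡ d
    ρ-ρ = trans (cong (λ z → rev (walk z (ρ d))) ℓ-ρ) (trans (cong rev (walk-ρ (ℓ d) 0 (+-identityʳ _))) (rev-rev d))

  start-not-inner : ∀ d d′ → Start d → Start d′ → ∀ i → i < ℓ d → walk (suc i) d ≢ d′
  start-not-inner d d′ d-start d′-start i i<ℓ e = ¬isDeg2∧isDeg3 _ d2
    (trans (cong isDeg3 (trans (sym (tl-walk-suc i d (proj₁ d-start) d2)) (cong tl e))) (proj₂ d′-start))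
    where d2 = ℓ-deg2 d (proj₁ d-start) i i<ℓ

  walk-cancel : ∀ d d′ → Start d → Start d′ → ∀ i j → i ≤ ℓ d → j ≤ ℓ d′ → walk i d ≡ walk j d′ → d ≡ d′ × i ≡ j
  walk-cancel d d′ d-start d′-start zero zero _ _ e = e , refl
  walk-cancel d d′ d-start d′-start (suc i) zero i<ℓ _ e = ⊥-elim (start-not-inner d d′ d-start d′-start i i<ℓ e)
  walk-cancel d d′ d-start d′-start zero (suc j) _ j<ℓ e = ⊥-elim (start-not-inner d′ d d′-start d-start j j<ℓ (sym e))
  walk-cancel d d′ d-start d′-start (suc i) (suc j) i<ℓ j<ℓ e with
    walk-cancel d d′ d-start d′-start i j (<⇒≤ i<ℓ) (<⇒≤ j<ℓ)
      (next-injective _ _ (walk-InF i d (proj₁ d-start)) (walk-InF j d′ (proj₁ d′-start)) d2 d′2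
        (trans (sym (walk-suc i d d2)) (trans e (walk-suc j d′ d′2))))
    where
    d2 = ℓ-deg2 d (proj₁ d-start) i i<ℓ
    d′2 = ℓ-deg2 d′ (proj₁ d′-start) j j<ℓ
  ... | d≡d′ , i≡j = d≡d′ , cong suc i≡j

  -- A thread never traverses an edge in both directions: reversing meets in the middle at a single
  -- dart (impossible) or at two consecutive darts on the same edge (impossible at a degree-2 vertex).
  walk-no-rev′ : ∀ d → InF d → ∀ t a b → a + t ≡ b → b ≤ ℓ d → walk a d ≢ rev (walk b d)
  walk-no-rev′ d d∈F zero a b e _ eq =
    rev≢ _ (sym (trans eq (cong (λ z → rev (walk z d)) (sym (trans (sym (+-identityʳ a)) e)))))
  walk-no-rev′ d d∈F (suc zero) a b e b≤ℓ eq =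
    next-edge≢ (walk a d) (walk-InF a d d∈F) d2
      (sym (trans (cong proj₁ eq) (trans (cong (λ z → proj₁ (walk z d)) b≡a+1) (cong proj₁ (walk-suc a d d2)))))
    where
    b≡a+1 : b ≡ suc a
    b≡a+1 = trans (sym e) (+-comm a 1)
    d2 = ℓ-deg2 d d∈F a (subst (_≤ ℓ d) b≡a+1 b≤ℓ)
  walk-no-rev′ d d∈F (suc (suc t)) a (suc b) e b<ℓ eq =
    walk-no-rev′ d d∈F t (suc a) b a+1+t≡b (<⇒≤ b<ℓ)
      (trans (walk-suc a d d2-a) (trans (cong next eq)
        (trans (cong (λ z → next (rev z)) (walk-suc b d d2-b)) (next-rev (walk b d) (walk-InF b d d∈F) d2-b))))
    where
    a+1+t≡b : suc a + t ≡ b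
    a+1+t≡b = cong pred (trans (cong suc (sym (+-suc a t))) (trans (sym (+-suc a (suc t))) e))
    d2-b = ℓ-deg2 d d∈F b b<ℓ
    d2-a = ℓ-deg2 d d∈F a (≤-trans (s≤s (+≡⇒≤ a (suc t) b (cong pred (trans (sym (+-suc a (suc t))) e)))) b<ℓ)
  walk-no-rev′ d d∈F (suc (suc t)) a zero e _ _ = 0≢1+n (trans (sym e) (+-suc a (suc t)))

  walk-no-rev : ∀ d → InF d → ∀ a b → a ≤ ℓ d → b ≤ ℓ d → walk a d ≢ rev (walk b d)
  walk-no-rev d d∈F a b a≤ℓ b≤ℓ eq with ≤-total a b
  ... | inj₁ a≤b = walk-no-rev′ d d∈F _ a b (proj₂ (m≤n⇒∃[o]m+o≡n a≤b)) b≤ℓ eq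
  ... | inj₂ b≤a = walk-no-rev′ d d∈F _ b a (proj₂ (m≤n⇒∃[o]m+o≡n b≤a)) a≤ℓ (trans (sym (rev-rev _)) (cong rev (sym eq)))

-- The multigraph K whose vertices are the degree-3 vertices and whose edges are the threads between them.
module BranchGraph {n m} (H : Multigraph n m) (loopless : ∀ e → proj₁ (ends H e) ≢ proj₂ (ends H e))
  (F : Subset m) (C : Subset n)
  (F-inside : ∀ e v → mem F e ≡ true → Incident H e v → mem C v ≡ true)
  (degree-2-or-3 : ∀ v → mem C v ≡ true → (degree H F v ≡ 2) ⊎ (degree H F v ≡ 3))
  (connected : ∀ u v → mem C u ≡ true → mem C v ≡ true → Reach H F u v)
  (v₃ : Fin n) (v₃∈C : mem C v₃ ≡ true) (v₃-deg3 : degree H F v₃ ≡ 3) where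

  open Threads H loopless F C F-inside degree-2-or-3 connected v₃ v₃∈C v₃-deg3 public

  rank : Dart m → ℕ
  rank d = toℕ (code d)

  rank-injective : ∀ d d′ → rank d ≡ rank d′ → d ≡ d′
  rank-injective d d′ e = code-injective d d′ (toℕ-injective e)

  -- Every thread is found twice, from each end; we keep the start of smaller rank.
  canonical : Dart m → Bool
  canonical d = (mem F (proj₁ d) ∧ isDeg3 (tl d)) ∧ does (rank d ≤? rank (ρ d))

  canonical⇒Start : ∀ d → canonical d ≡ true → Start d
  canonical⇒Start d c = ∧-conicalˡ _ _ start , ∧-conicalʳ (mem F (proj₁ d)) _ start
    where start = ∧-conicalˡ (mem F (proj₁ d) ∧ isDeg3 (tl d)) _ c

  canonical⇒≤ : ∀ d → canonical d ≡ true → rank d ≤ rank (ρ d)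
  canonical⇒≤ d c = does-true (rank d ≤? rank (ρ d)) (∧-conicalʳ (mem F (proj₁ d) ∧ isDeg3 (tl d)) _ c)

  ≤⇒canonical : ∀ d → Start d → rank d ≤ rank (ρ d) → canonical d ≡ true
  ≤⇒canonical d (d∈F , d3) le rewrite d∈F | d3 = does-yes (rank d ≤? rank (ρ d)) le

  ρ-canonical : ∀ d → Start d → canonical d ≡ false → canonical (ρ d) ≡ true
  ρ-canonical d d-start c with ≤-total (rank d) (rank (ρ d))
  ... | inj₁ le = ⊥-elim (false≢true (trans (sym c) (≤⇒canonical d d-start le)))
  ... | inj₂ ge = ≤⇒canonical (ρ d) (Started.ρ-Start d d-start)
                    (subst (λ z → rank (ρ d) ≤ rank z) (sym (Started.ρ-ρ d d-start)) ge)

  ρ≢ : ∀ d → Start d → ρ d ≢ d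
  ρ≢ d d-start e = walk-no-rev d (proj₁ d-start) 0 (ℓ d) z≤n ≤-refl (sym e)

  canonical-ρ : ∀ d d′ → canonical d ≡ true → canonical d′ ≡ true → d ≢ ρ d′
  canonical-ρ d d′ c c′ refl = ρ≢ d′ d′-start (sym (rank-injective _ _ (≤-antisym (canonical⇒≤ d′ c′)
      (subst (λ z → rank (ρ d′) ≤ rank z) (Started.ρ-ρ d′ d′-start) (canonical⇒≤ (ρ d′) c)))))
    where d′-start = canonical⇒Start d′ c′

  opaque
    branchEnum : Enumeration isDeg3
    branchEnum = enumerate isDeg3

    p : ℕ
    p = Enumeration.size branchEnum

    branch′ : Fin p → Fin n
    branch′ = Enumeration.elem branchEnum

    startEnum : Enumeration (λ x → canonical (decode {m} x))
    startEnum = enumerate (λ x → canonical (decode {m} x))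

    q : ℕ
    q = Enumeration.size startEnum

    start : Fin q → Dart m
    start f = decode {m} (Enumeration.elem startEnum f)

    start-canonical : ∀ f → canonical (start f) ≡ true
    start-canonical f = Enumeration.elem-P startEnum f

    start-injective : ∀ f f′ → start f ≡ start f′ → f ≡ f′
    start-injective f f′ e = Enumeration.elem-injective startEnum f f′ (decode-injective {m} _ _ e)

    start-surjective : ∀ d → canonical d ≡ true → ∃ λ f → start f ≡ d
    start-surjective d c with Enumeration.elem-surjective startEnum (code d) (subst (λ z → canonical z ≡ true) (sym (decode-code d)) c)
    ... | f , e = f , trans (cong decode e) (decode-code d)

    branchIndex : ∀ v → isDeg3 v ≡ true → Fin p
    branchIndex v v3 = proj₁ (Enumeration.elem-surjective branchEnum v v3)

    branch-branchIndex : ∀ v v3 → branch′ (branchIndex v v3) ≡ v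
    branch-branchIndex v v3 = proj₂ (Enumeration.elem-surjective branchEnum v v3)

    branch-deg3 : ∀ x → isDeg3 (branch′ x) ≡ true
    branch-deg3 = Enumeration.elem-P branchEnum

    branch-injective : ∀ x y → branch′ x ≡ branch′ y → x ≡ y
    branch-injective = Enumeration.elem-injective branchEnum

  start-Start : ∀ f → Start (start f)
  start-Start f = canonical⇒Start (start f) (start-canonical f)

  start-InF : ∀ f → InF (start f)
  start-InF f = proj₁ (start-Start f)

  endDart : Fin q → Dart m
  endDart f = walk (ℓ (start f)) (start f)

  K : Multigraph p q
  K = record { ends = λ f → branchIndex (tl (start f)) (proj₂ (start-Start f))
                          , branchIndex (hd (endDart f)) (ℓ-deg3 (start f) (start-InF f)) }

  thread-no-rev : ∀ f g a b → a ≤ ℓ (start f) → b ≤ ℓ (start g) → walk a (start f) ≢ rev (walk b (start g))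
  thread-no-rev f g a b a≤ℓ b≤ℓ e =
    canonical-ρ (start f) (start g) (start-canonical f) (start-canonical g)
      (proj₁ (walk-cancel (start f) (ρ (start g)) (start-Start f) (Started.ρ-Start (start g) (start-Start g)) a (ℓ (start g) ∸ b) a≤ℓ
        (subst (ℓ (start g) ∸ b ≤_) (sym (Started.ℓ-ρ (start g) (start-Start g))) (m∸n≤m _ b))
        (trans e (sym (Started.walk-ρ (start g) (start-Start g) (ℓ (start g) ∸ b) b (m∸n+n≡m b≤ℓ))))))

  vertexAt : ∀ f → Fin (suc (suc (ℓ (start f)))) → Fin n
  vertexAt f zero = tl (start f)
  vertexAt f (suc j) = hd (walk (toℕ j) (start f))

  edgeAt : ∀ f → Fin (suc (ℓ (start f))) → Fin m
  edgeAt f i = proj₁ (walk (toℕ i) (start f))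

  vertexAt-inject₁ : ∀ f (i : Fin (suc (ℓ (start f)))) → vertexAt f (inject₁ i) ≡ tl (walk (toℕ i) (start f))
  vertexAt-inject₁ f zero = refl
  vertexAt-inject₁ f (suc i) = trans (cong (λ z → hd (walk z (start f))) (toℕ-inject₁ i))
    (sym (tl-walk-suc (toℕ i) (start f) (start-InF f) (ℓ-deg2 (start f) (start-InF f) (toℕ i) (toℕ<n i))))

  position : ∀ f k → k ≤ ℓ (start f) → Fin (suc (ℓ (start f)))
  position f k k≤ℓ = fromℕ< (s≤s k≤ℓ)

  edgeAt-position : ∀ f k k≤ℓ → edgeAt f (position f k k≤ℓ) ≡ proj₁ (walk k (start f))
  edgeAt-position f k k≤ℓ = cong (λ z → proj₁ (walk z (start f))) (toℕ-fromℕ< (s≤s k≤ℓ))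

  -- Walking backwards along e to a degree-3 vertex gives a start s whose thread contains e; s or ρ s is canonical.
  edge-covered : ∀ e → mem F e ≡ true → ∃₂ λ f i → edgeAt f i ≡ e
  edge-covered e e∈F = by-case (canonical s) refl
    where
    a : Dart m
    a = e , true
    k = ℓ a
    s = rev (walk k a)
    s-start : Start s
    s-start = walk-InF k a e∈F , trans (cong isDeg3 (tl-rev (walk k a))) (ℓ-deg3 a e∈F)
    k≤ℓs : k ≤ ℓ s
    k≤ℓs = μ-≥ (hitsDeg3 s) N k (ℓ-≤ a) (walk-rev-¬hitsDeg3 a e∈F k (ℓ-deg2 a e∈F))
    walk-k-s : proj₁ (walk k s) ≡ e
    walk-k-s = cong proj₁ (walk-rev a e∈F k (ℓ-deg2 a e∈F) k 0 (+-identityʳ k))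
    by-case : ∀ b → canonical s ≡ b → ∃₂ λ f i → edgeAt f i ≡ e
    by-case true c with start-surjective s c
    ... | f , start≡s = f , position f k k≤ℓ , trans (edgeAt-position f k k≤ℓ)
                          (trans (cong (λ z → proj₁ (walk k z)) start≡s) walk-k-s)
      where k≤ℓ = subst (λ z → k ≤ ℓ z) (sym start≡s) k≤ℓs
    by-case false c with start-surjective (ρ s) (ρ-canonical s s-start c)
    ... | f , start≡ρs = f , position f (ℓ s ∸ k) i≤ℓ , trans (edgeAt-position f _ i≤ℓ)
                           (trans (cong (λ z → proj₁ (walk (ℓ s ∸ k) z)) start≡ρs)
                             (trans (cong proj₁ (Started.walk-ρ s s-start (ℓ s ∸ k) k (m∸n+n≡m k≤ℓs))) walk-k-s))
      where i≤ℓ = subst (λ z → ℓ s ∸ k ≤ ℓ z) (sym start≡ρs) (subst (ℓ s ∸ k ≤_) (sym (Started.ℓ-ρ s s-start)) (m∸n≤m (ℓ s) k))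

  edgeAt-unique : ∀ f i g j → edgeAt f i ≡ edgeAt g j → f ≡ g × toℕ i ≡ toℕ j
  edgeAt-unique f i g j eq with same-edge (walk (toℕ i) (start f)) (walk (toℕ j) (start g)) eq
  ... | inj₁ same with walk-cancel (start f) (start g) (start-Start f) (start-Start g) (toℕ i) (toℕ j)
                         (≤-pred (toℕ<n i)) (≤-pred (toℕ<n j)) same
  ...   | start≡ , i≡j = start-injective f g start≡ , i≡j
  edgeAt-unique f i g j eq | inj₂ reversed = ⊥-elim (thread-no-rev f g (toℕ i) (toℕ j) (≤-pred (toℕ<n i)) (≤-pred (toℕ<n j)) reversed)

  inner-hd : ∀ f (i : Fin (ℓ (start f))) → vertexAt f (inner i) ≡ hd (walk (toℕ i) (start f))
  inner-hd f i = cong (λ z → hd (walk z (start f))) (toℕ-inject₁ i)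

  inner-deg2 : ∀ f (i : Fin (ℓ (start f))) → isDeg2 (vertexAt f (inner i)) ≡ true
  inner-deg2 f i = trans (cong isDeg2 (inner-hd f i)) (ℓ-deg2 (start f) (start-InF f) (toℕ i) (toℕ<n i))

  inner-unique′ : ∀ f (i : Fin (ℓ (start f))) g (j : Fin (ℓ (start g))) →
    vertexAt f (inner i) ≡ vertexAt g (inner j) → f ≡ g × toℕ i ≡ toℕ j
  inner-unique′ f i g j eq
    with darts-from-deg2 y (walk-InF (toℕ j) (start g) (start-InF g)) y2 x (walk-InF (suc (toℕ i)) (start f) (start-InF f)) tl-x
    where
    y = walk (toℕ j) (start g)
    y2 = ℓ-deg2 (start g) (start-InF g) (toℕ j) (toℕ<n j)
    x = walk (suc (toℕ i)) (start f)
    tl-x : tl x ≡ hd y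
    tl-x = trans (tl-walk-suc (toℕ i) (start f) (start-InF f) (ℓ-deg2 (start f) (start-InF f) (toℕ i) (toℕ<n i)))
             (trans (sym (inner-hd f i)) (trans eq (inner-hd g j)))
  ... | inj₁ x≡next with walk-cancel (start f) (start g) (start-Start f) (start-Start g) (suc (toℕ i)) (suc (toℕ j)) (toℕ<n i) (toℕ<n j)
                           (trans x≡next (sym (walk-suc (toℕ j) (start g) (ℓ-deg2 (start g) (start-InF g) (toℕ j) (toℕ<n j)))))
  ...   | start≡ , i≡j = start-injective f g start≡ , cong pred i≡j
  inner-unique′ f i g j eq | inj₂ x≡rev = ⊥-elim (thread-no-rev f g (suc (toℕ i)) (toℕ j) (toℕ<n i) (<⇒≤ (toℕ<n j)) x≡rev)

  deg3∈C : ∀ v → isDeg3 v ≡ true → mem C v ≡ true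
  deg3∈C v v3 = F-inside a v a∈ a-at
    where open Star₃ (star₃ F v (isDeg3⇒ v v3))

  hd-inner : ∀ f k → k ≤ ℓ (start f) → isDeg2 (hd (walk k (start f))) ≡ true →
    ∃ λ (i : Fin (ℓ (start f))) → vertexAt f (inner i) ≡ hd (walk k (start f))
  hd-inner f k k≤ℓ d2 with m≤n⇒m<n∨m≡n k≤ℓ
  ... | inj₂ refl = ⊥-elim (¬isDeg2∧isDeg3 _ d2 (ℓ-deg3 (start f) (start-InF f)))
  ... | inj₁ k<ℓ = fromℕ< k<ℓ , trans (inner-hd f (fromℕ< k<ℓ)) (cong (λ z → hd (walk z (start f))) (toℕ-fromℕ< k<ℓ))

  tl-inner : ∀ f k → k ≤ ℓ (start f) → isDeg2 (tl (walk k (start f))) ≡ true →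
    ∃ λ (i : Fin (ℓ (start f))) → vertexAt f (inner i) ≡ tl (walk k (start f))
  tl-inner f zero _ d2 = ⊥-elim (¬isDeg2∧isDeg3 _ d2 (proj₂ (start-Start f)))
  tl-inner f (suc k) k<ℓ d2 = proj₁ found , trans (proj₂ found) (sym tl≡)
    where
    tl≡ = tl-walk-suc k (start f) (start-InF f) (ℓ-deg2 (start f) (start-InF f) k k<ℓ)
    found = hd-inner f k (<⇒≤ k<ℓ) (trans (cong isDeg2 (sym tl≡)) d2)

  -- A degree-2 vertex is an end of an F-edge, which lies on a thread that passes through the vertex.
  deg2-inner : ∀ v → isDeg2 v ≡ true → ∃₂ λ f (i : Fin (ℓ (start f))) → vertexAt f (inner i) ≡ v
  deg2-inner v d2 with star₂ F v (isDeg2⇒ v d2)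
  ... | s with dart-into (Star₂.a s) v (Star₂.a-at s) | edge-covered (Star₂.a s) (Star₂.a∈ s)
  ...   | b , hd≡v | f , i , edge≡ with same-edge (walk (toℕ i) (start f)) (Star₂.a s , b) edge≡
  ...     | inj₁ same = f , proj₁ found , trans (proj₂ found) hd≡
    where
    hd≡ : hd (walk (toℕ i) (start f)) ≡ v
    hd≡ = trans (cong hd same) hd≡v
    found = hd-inner f (toℕ i) (≤-pred (toℕ<n i)) (trans (cong isDeg2 hd≡) d2)
  ...     | inj₂ reversed = f , proj₁ found , trans (proj₂ found) tl≡
    where
    tl≡ : tl (walk (toℕ i) (start f)) ≡ v
    tl≡ = trans (cong tl reversed) (trans (tl-rev (Star₂.a s , b)) hd≡v)
    found = tl-inner f (toℕ i) (≤-pred (toℕ<n i)) (trans (cong isDeg2 tl≡) d2)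

  vertex-covered : ∀ v → mem C v ≡ true →
    (∃ λ x → branch′ x ≡ v) ⊎ (∃₂ λ f (i : Fin (ℓ (start f))) → vertexAt f (inner i) ≡ v)
  vertex-covered v v∈C with isDeg3 v in v3
  ... | true = inj₁ (branchIndex v v3 , branch-branchIndex v v3)
  ... | false = inj₂ (deg2-inner v (¬isDeg3⇒isDeg2 v v∈C v3))

  subdivision : Subdivision H C F K
  subdivision = record
    { branch = branch′
    ; branch-inj = branch-injective
    ; branch-in = λ x → mem⇒∈ (deg3∈C (branch′ x) (branch-deg3 x))
    ; len = λ f → ℓ (start f)
    ; pedge = edgeAt
    ; pvert = vertexAt
    ; pvert-start = λ f → sym (branch-branchIndex _ _)
    ; pvert-end = λ f → trans (cong (λ z → hd (walk z (start f))) (toℕ-fromℕ (ℓ (start f)))) (sym (branch-branchIndex _ _))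
    ; pedge-joins = λ f i → subst (λ z → Joins H (edgeAt f i) z (vertexAt f (suc i))) (sym (vertexAt-inject₁ f i))
                              (dart-joins (walk (toℕ i) (start f)))
    ; pedge-in = λ f i → mem⇒∈ (walk-InF (toℕ i) (start f) (start-InF f))
    ; pedge-cover = λ e e∈F → edge-covered e (∈⇒mem e∈F)
    ; pedge-unique = edgeAt-unique
    ; inner-in = λ f i → mem⇒∈ (trans (cong (mem C) (inner-hd f i))
                                   (hd∈C (walk (toℕ i) (start f)) (walk-InF (toℕ i) (start f) (start-InF f))))
    ; inner-new = λ f i x e → ¬isDeg2∧isDeg3 _ (inner-deg2 f i) (trans (cong isDeg3 e) (branch-deg3 x))
    ; inner-unique = inner-unique′
    ; vert-cover = λ v v∈C → vertex-covered v (∈⇒mem v∈C)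
    }

  ρ≡⇒≡ρ : ∀ f δ → ρ (start f) ≡ δ → start f ≡ ρ δ
  ρ≡⇒≡ρ f δ e = trans (sym (Started.ρ-ρ (start f) (start-Start f))) (cong ρ e)

  -- How often δ is an end dart (first dart or reversed last dart) of the thread of f.
  endCount : Dart m → Fin q → ℕ
  endCount δ f = indicator (start f ≟ᵈ δ) + indicator (ρ (start f) ≟ᵈ δ)

  -- Every start is an end dart of exactly one thread: as its first dart if it is canonical, else reversed.
  each-start-once : ∀ δ → Start δ → ∑ (endCount δ) ≡ 1
  each-start-once δ δ-start = by-case (canonical δ) refl
    where
    by-case : ∀ b → canonical δ ≡ b → ∑ (endCount δ) ≡ 1
    by-case true c with start-surjective δ c
    ... | f₀ , start≡δ = trans (∑-cong only-f₀) (∑-single f₀ 1)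
      where
      only-f₀ : ∀ f → endCount δ f ≡ (if does (f ≟ f₀) then 1 else 0)
      only-f₀ f with f ≟ f₀
      ... | yes refl = cong₂ _+_ (indicator-yes (start f ≟ᵈ δ) start≡δ)
                         (indicator-no (ρ (start f) ≟ᵈ δ) (λ e → ρ≢ δ δ-start (trans (cong ρ (sym start≡δ)) e)))
      ... | no f≢f₀ = cong₂ _+_ (indicator-no (start f ≟ᵈ δ) (λ e → f≢f₀ (start-injective f f₀ (trans e (sym start≡δ)))))
                        (indicator-no (ρ (start f) ≟ᵈ δ) (λ e → canonical-ρ (start f) δ (start-canonical f) c (ρ≡⇒≡ρ f δ e)))
    by-case false c with start-surjective (ρ δ) (ρ-canonical δ δ-start c)
    ... | f₀ , start≡ρδ = trans (∑-cong only-f₀) (∑-single f₀ 1)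
      where
      only-f₀ : ∀ f → endCount δ f ≡ (if does (f ≟ f₀) then 1 else 0)
      only-f₀ f with f ≟ f₀
      ... | yes refl = cong₂ _+_ (indicator-no (start f ≟ᵈ δ) (λ e → ρ≢ δ δ-start (trans (sym start≡ρδ) e)))
                         (indicator-yes (ρ (start f) ≟ᵈ δ) (trans (cong ρ start≡ρδ) (Started.ρ-ρ δ δ-start)))
      ... | no f≢f₀ = cong₂ _+_
                        (indicator-no (start f ≟ᵈ δ) (λ e → false≢true (trans (sym c) (trans (cong canonical (sym e)) (start-canonical f)))))
                        (indicator-no (ρ (start f) ≟ᵈ δ) (λ e → f≢f₀ (start-injective f f₀ (trans (ρ≡⇒≡ρ f δ e) (sym start≡ρδ)))))

  module AtBranch (x : Fin p) where
    v = branch′ x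
    v3 : isDeg3 v ≡ true
    v3 = branch-deg3 x
    open Star₃ (star₃ F v (isDeg3⇒ v v3)) renaming (a to e₁; b to e₂; c to e₃; a≢b to e₁≢e₂; a≢c to e₁≢e₃; b≢c to e₂≢e₃;
      a∈ to e₁∈F; b∈ to e₂∈F; c∈ to e₃∈F; a-at to e₁-at; b-at to e₂-at; c-at to e₃-at)

    δ₁ δ₂ δ₃ : Dart m
    δ₁ = dartFrom e₁ v
    δ₂ = dartFrom e₂ v
    δ₃ = dartFrom e₃ v

    δ₁-Start : Start δ₁
    δ₁-Start = e₁∈F , trans (cong isDeg3 (tl-dartFrom e₁ v e₁-at)) v3
    δ₂-Start : Start δ₂
    δ₂-Start = e₂∈F , trans (cong isDeg3 (tl-dartFrom e₂ v e₂-at)) v3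
    δ₃-Start : Start δ₃
    δ₃-Start = e₃∈F , trans (cong isDeg3 (tl-dartFrom e₃ v e₃-at)) v3

    hit : ∀ d → tl d ≡ v → ∀ {e} → proj₁ d ≡ e → indicator (d ≟ᵈ dartFrom e v) ≡ 1
    hit d tl≡v refl = indicator-yes (d ≟ᵈ dartFrom (proj₁ d) v) (sym (dartFrom-tl d v tl≡v))

    miss : ∀ d {e} → proj₁ d ≢ e → indicator (d ≟ᵈ dartFrom e v) ≡ 0
    miss d {e} ne = indicator-no (d ≟ᵈ dartFrom e v) (ne ∘ cong proj₁)

    darts-from-v : ∀ d → InF d → indicator (tl d ≟ v) ≡ indicator (d ≟ᵈ δ₁) + (indicator (d ≟ᵈ δ₂) + indicator (d ≟ᵈ δ₃))
    darts-from-v d d∈F with tl d ≟ v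
    ... | no tl≢v = sym (cong₂ _+_ (away e₁-at) (cong₂ _+_ (away e₂-at) (away e₃-at)))
      where
      away : ∀ {e} → Incident H e v → indicator (d ≟ᵈ dartFrom e v) ≡ 0
      away {e} e-at = indicator-no (d ≟ᵈ dartFrom e v) (λ eq → tl≢v (trans (cong tl eq) (tl-dartFrom _ v e-at)))
    ... | yes tl≡v with only (proj₁ d) d∈F (subst (Incident H (proj₁ d)) tl≡v (incident-tl d))
    ...   | inj₁ q = sym (cong₂ _+_ (hit d tl≡v q)
                             (cong₂ _+_ (miss d (e₁≢e₂ ∘ trans (sym q))) (miss d (e₁≢e₃ ∘ trans (sym q)))))
    ...   | inj₂ (inj₁ q) = sym (cong₂ _+_ (miss d (λ z → e₁≢e₂ (trans (sym z) q)))
                                    (cong₂ _+_ (hit d tl≡v q) (miss d (e₂≢e₃ ∘ trans (sym q)))))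
    ...   | inj₂ (inj₂ q) = sym (cong₂ _+_ (miss d (λ z → e₁≢e₃ (trans (sym z) q)))
                                    (cong₂ _+_ (miss d (λ z → e₂≢e₃ (trans (sym z) q))) (hit d tl≡v q)))

    indicator-branchIndex : ∀ u (u3 : isDeg3 u ≡ true) → indicator (branchIndex u u3 ≟ x) ≡ indicator (u ≟ v)
    indicator-branchIndex u u3 with branchIndex u u3 ≟ x
    ... | yes e = sym (indicator-yes (u ≟ v) (trans (sym (branch-branchIndex u u3)) (cong branch′ e)))
    ... | no ne = sym (indicator-no (u ≟ v) (λ e → ne (branch-injective _ _ (trans (branch-branchIndex u u3) e))))

    inc-K : ∀ f → inc (ends K f) x ≡ endCount δ₁ f + (endCount δ₂ f + endCount δ₃ f)
    inc-K f = begin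
      inc (ends K f) x
        ≡⟨ cong₂ _+_ (trans (indicator-branchIndex _ _) (darts-from-v (start f) (start-InF f)))
                     (trans (indicator-branchIndex _ _) (trans (cong (λ z → indicator (z ≟ v)) (sym (tl-rev (endDart f))))
                       (darts-from-v (ρ (start f)) (proj₁ (Started.ρ-Start (start f) (start-Start f)))))) ⟩
      (A δ₁ + (A δ₂ + A δ₃)) + (B δ₁ + (B δ₂ + B δ₃))
        ≡⟨ interchange (A δ₁) (A δ₂ + A δ₃) (B δ₁) (B δ₂ + B δ₃) ⟩
      endCount δ₁ f + ((A δ₂ + A δ₃) + (B δ₂ + B δ₃))
        ≡⟨ cong (endCount δ₁ f +_) (interchange (A δ₂) (A δ₃) (B δ₂) (B δ₃)) ⟩
      endCount δ₁ f + (endCount δ₂ f + endCount δ₃ f) ∎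
      where
      open ≡-Reasoning
      A B : Dart m → ℕ
      A δ = indicator (start f ≟ᵈ δ)
      B δ = indicator (ρ (start f) ≟ᵈ δ)

    degree-K : ∑ (λ f → inc (ends K f) x) ≡ 3
    degree-K = trans (∑-cong inc-K) (trans (∑-+ (endCount δ₁) _) (cong₂ _+_ (each-start-once δ₁ δ₁-Start)
      (trans (∑-+ (endCount δ₂) _) (cong₂ _+_ (each-start-once δ₂ δ₂-Start) (each-start-once δ₃ δ₃-Start)))))

  K-cubic : Cubic K
  K-cubic x = trans (∑-cong (λ f → cong (λ z → if z then inc (ends K f) x else 0) (mem-⊤ f))) (AtBranch.degree-K x)

subdivision-of-cubic : ∀ {n m} (H : Multigraph n m) → (∀ e → proj₁ (ends H e) ≢ proj₂ (ends H e)) →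
  (C : Subset n) (F : Subset m) →
  (∀ e v → mem F e ≡ true → Incident H e v → mem C v ≡ true) →
  (∀ v → mem C v ≡ true → (degree H F v ≡ 2) ⊎ (degree H F v ≡ 3)) →
  (∀ u v → mem C u ≡ true → mem C v ≡ true → Reach H F u v) →
  (∃ λ v → mem C v ≡ true × degree H F v ≡ 3) →
  Σ ℕ λ p → Σ ℕ λ q → Σ (Multigraph p q) λ K → Cubic K × Subdivision H C F K
subdivision-of-cubic H loopless C F F-inside degree-2-or-3 connected (v₃ , v₃∈C , v₃-deg3) =
  p , q , K , K-cubic , subdivision
  where open BranchGraph H loopless F C F-inside degree-2-or-3 connected v₃ v₃∈C v₃-deg3

-- The core of three 1-factors

inMatching inCore inTriple : Bool → Bool → Bool → Bool
inMatching x y z = ((x ∧ y) ∨ (x ∧ z)) ∨ (y ∧ z)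
inCore x y z = inMatching x y z ∨ not ((x ∨ y) ∨ z)
inTriple x y z = (x ∧ y) ∧ z

-- The three possible local pictures at a vertex, as (core degree, 𝓜-degree, triple-degree).
data CoreDegrees (c μ τ : ℕ) : Set where
  outside   : c ≡ 0 → CoreDegrees c μ τ
  subdivide : c ≡ 2 → μ ≡ 1 → τ ≡ 0 → CoreDegrees c μ τ
  branching : c ≡ 3 → μ ≡ 1 → τ ≡ 1 → CoreDegrees c μ τ

-- How many of the three star edges, with memberships (a_i, b_i, c_i) in M_i, satisfy f.
starCount : (Bool → Bool → Bool → Bool) → (a₁ b₁ c₁ a₂ b₂ c₂ a₃ b₃ c₃ : Bool) → ℕ
starCount f a₁ b₁ c₁ a₂ b₂ c₂ a₃ b₃ c₃ = bit (f a₁ a₂ a₃) + (bit (f b₁ b₂ b₃) + bit (f c₁ c₂ c₃))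

local-coreDegrees : ∀ {a₁ b₁ c₁ a₂ b₂ c₂ a₃ b₃ c₃} →
  OneHot a₁ b₁ c₁ → OneHot a₂ b₂ c₂ → OneHot a₃ b₃ c₃ →
  CoreDegrees (starCount inCore a₁ b₁ c₁ a₂ b₂ c₂ a₃ b₃ c₃) (starCount inMatching a₁ b₁ c₁ a₂ b₂ c₂ a₃ b₃ c₃)
              (starCount inTriple a₁ b₁ c₁ a₂ b₂ c₂ a₃ b₃ c₃)
local-coreDegrees first first first = branching refl refl refl
local-coreDegrees first first second = subdivide refl refl refl
local-coreDegrees first first third = subdivide refl refl refl
local-coreDegrees first second first = subdivide refl refl refl
local-coreDegrees first second second = subdivide refl refl refl
local-coreDegrees first second third = outside refl
local-coreDegrees first third first = subdivide refl refl refl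
local-coreDegrees first third second = outside refl
local-coreDegrees first third third = subdivide refl refl refl
local-coreDegrees second first first = subdivide refl refl refl
local-coreDegrees second first second = subdivide refl refl refl
local-coreDegrees second first third = outside refl
local-coreDegrees second second first = subdivide refl refl refl
local-coreDegrees second second second = branching refl refl refl
local-coreDegrees second second third = subdivide refl refl refl
local-coreDegrees second third first = outside refl
local-coreDegrees second third second = subdivide refl refl refl
local-coreDegrees second third third = subdivide refl refl refl
local-coreDegrees third first first = subdivide refl refl refl
local-coreDegrees third first second = outside refl
local-coreDegrees third first third = subdivide refl refl refl
local-coreDegrees third second first = outside refl
local-coreDegrees third second second = subdivide refl refl refl
local-coreDegrees third second third = subdivide refl refl refl
local-coreDegrees third third first = subdivide refl refl refl
local-coreDegrees third third second = subdivide refl refl refl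
local-coreDegrees third third third = branching refl refl refl

inTriple⇒₁ : ∀ x y z → inTriple x y z ≡ true → x ≡ true
inTriple⇒₁ true y z _ = refl

inTriple⇒inCore : ∀ x y z → inTriple x y z ≡ true → inCore x y z ≡ true
inTriple⇒inCore true true true _ = refl

inMatching⇒inCore : ∀ x y z → inMatching x y z ≡ true → inCore x y z ≡ true
inMatching⇒inCore x y z p rewrite p = refl

module CoreOf {n m} (G : Graph n m) (cubic : Cubic (mg G)) (M₁ M₂ M₃ : Subset m)
  (f₁ : OneFactor (mg G) M₁) (f₂ : OneFactor (mg G) M₂) (f₃ : OneFactor (mg G) M₃) where

  H : Multigraph n m
  H = mg G
  open Loopless H (loopless G) public

  core matching triple : Subset m
  core = coreEdges M₁ M₂ M₃
  matching = 𝓜 M₁ M₂ M₃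
  triple = (M₁ ∩ M₂) ∩ M₃

  mem-matching : ∀ e → mem matching e ≡ inMatching (mem M₁ e) (mem M₂ e) (mem M₃ e)
  mem-matching e rewrite mem-∪ ((M₁ ∩ M₂) ∪ (M₁ ∩ M₃)) (M₂ ∩ M₃) e | mem-∪ (M₁ ∩ M₂) (M₁ ∩ M₃) e
    | mem-∩ M₁ M₂ e | mem-∩ M₁ M₃ e | mem-∩ M₂ M₃ e = refl

  mem-core : ∀ e → mem core e ≡ inCore (mem M₁ e) (mem M₂ e) (mem M₃ e)
  mem-core e rewrite mem-∪ matching (𝓤 M₁ M₂ M₃) e | mem-matching e | mem-∁ ((M₁ ∪ M₂) ∪ M₃) e
    | mem-∪ (M₁ ∪ M₂) M₃ e | mem-∪ M₁ M₂ e = refl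

  mem-triple : ∀ e → mem triple e ≡ inTriple (mem M₁ e) (mem M₂ e) (mem M₃ e)
  mem-triple e rewrite mem-∩ (M₁ ∩ M₂) M₃ e | mem-∩ M₁ M₂ e = refl

  opaque
    fullStar : ∀ v → Star₃ ⊤ v
    fullStar v = star₃ ⊤ v (cubic v)

  module _ (v : Fin n) where
    open Star₃ (fullStar v)

    oneHot-at : ∀ M → OneFactor H M → OneHot (mem M a) (mem M b) (mem M c)
    oneHot-at M f = oneHot-star (fullStar v) M (star₁ M v (f v))

    coreDegrees : CoreDegrees (degree H core v) (degree H matching v) (degree H triple v)
    coreDegrees rewrite degree-star (fullStar v) core | degree-star (fullStar v) matching
      | degree-star (fullStar v) triple
      | mem-core a | mem-core b | mem-core c | mem-matching a | mem-matching b | mem-matching c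
      | mem-triple a | mem-triple b | mem-triple c =
      local-coreDegrees (oneHot-at M₁ f₁) (oneHot-at M₂ f₂) (oneHot-at M₃ f₃)

  triple⇒M₁ : ∀ e → mem triple e ≡ true → mem M₁ e ≡ true
  triple⇒M₁ e p = inTriple⇒₁ (mem M₁ e) (mem M₂ e) (mem M₃ e) (trans (sym (mem-triple e)) p)

  triple⇒core : ∀ e → mem triple e ≡ true → mem core e ≡ true
  triple⇒core e p = trans (mem-core e)
    (inTriple⇒inCore (mem M₁ e) (mem M₂ e) (mem M₃ e) (trans (sym (mem-triple e)) p))

  matching⇒core : ∀ e → mem matching e ≡ true → mem core e ≡ true
  matching⇒core e p = trans (mem-core e)
    (inMatching⇒inCore (mem M₁ e) (mem M₂ e) (mem M₃ e) (trans (sym (mem-matching e)) p))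

  triple-unique : ∀ v e e′ → mem triple e ≡ true → Incident H e v → mem triple e′ ≡ true → Incident H e′ v → e ≡ e′
  triple-unique v e e′ p e-at p′ e′-at =
    trans (only e (triple⇒M₁ e p) e-at) (sym (only e′ (triple⇒M₁ e′ p′) e′-at))
    where open Star₁ (star₁ M₁ v (f₁ v))

  inV⇒coreDegree≢0 : ∀ v → InV H core v → degree H core v ≢ 0
  inV⇒coreDegree≢0 v (e , e∈ , e-at) = incident⇒degree≢0 core v e (∈⇒mem e∈) e-at

  matching-oneFactor : ∀ v → InV H core v → degree H matching v ≡ 1
  matching-oneFactor v v∈ with coreDegrees v
  ... | outside c≡0 = ⊥-elim (inV⇒coreDegree≢0 v v∈ c≡0)
  ... | subdivide _ μ≡1 _ = μ≡1
  ... | branching _ μ≡1 _ = μ≡1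

  triple⇒coreDegree3 : ∀ v e → mem triple e ≡ true → Incident H e v → degree H core v ≡ 3
  triple⇒coreDegree3 v e p e-at with coreDegrees v
  ... | outside c≡0 = ⊥-elim (incident⇒degree≢0 core v e (triple⇒core e p) e-at c≡0)
  ... | subdivide _ _ τ≡0 = ⊥-elim (incident⇒degree≢0 triple v e p e-at τ≡0)
  ... | branching c≡3 _ _ = c≡3

  coreDegree3⇒triple : ∀ v → degree H core v ≡ 3 → ∃ λ e → mem triple e ≡ true × Incident H e v
  coreDegree3⇒triple v d with coreDegrees v
  ... | outside c≡0 = ⊥-elim (0≢1+n (trans (sym c≡0) d))
  ... | subdivide c≡2 _ _ = ⊥-elim (3≢2 (trans (sym d) c≡2))
    where 3≢2 : 3 ≢ 2
          3≢2 ()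
  ... | branching _ _ τ≡1 = a , a∈ , a-at
    where open Star₁ (star₁ triple v τ≡1)

if-single-edge : ∀ {l b X} → l ≡ 0 → b ≡ true → (if does (l ≟ℕ 0) ∧ b then X else 0) ≡ X
if-single-edge refl refl = refl

if-single-edge-0 : ∀ {l b X} → (l ≡ 0 → b ≡ true → X ≡ 0) → (if does (l ≟ℕ 0) ∧ b then X else 0) ≡ 0
if-single-edge-0 {zero} {true} h = h refl refl
if-single-edge-0 {zero} {false} h = refl
if-single-edge-0 {suc l} h = refl

module CoreComponent {n m} (G : Graph n m) (cubic : Cubic (mg G)) (M₁ M₂ M₃ : Subset m)
  (f₁ : OneFactor (mg G) M₁) (f₂ : OneFactor (mg G) M₂) (f₃ : OneFactor (mg G) M₃)
  (C : Subset n) (comp : IsComponent (mg G) (coreEdges M₁ M₂ M₃) C) where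

  open CoreOf G cubic M₁ M₂ M₃ f₁ f₂ f₃ public
  open ComponentOf H (loopless G) core C comp public

  C⇒inV : ∀ v → mem C v ≡ true → InV H core v
  C⇒inV v v∈C = IsComponent.inV comp v (mem⇒∈ v∈C)

  degree-2-or-3 : ∀ v → mem C v ≡ true → (degree H F v ≡ 2) ⊎ (degree H F v ≡ 3)
  degree-2-or-3 v v∈C rewrite degree-F v v∈C with coreDegrees v
  ... | outside c≡0 = ⊥-elim (inV⇒coreDegree≢0 v (C⇒inV v v∈C) c≡0)
  ... | subdivide c≡2 _ _ = inj₁ c≡2
  ... | branching c≡3 _ _ = inj₂ c≡3

  degTerm-F∩matching : ∀ v → mem C v ≡ true → ∀ e → degTerm (F ∩ matching) v e ≡ degTerm matching v e
  degTerm-F∩matching v v∈C e rewrite mem-∩ F matching e with mem matching e in e∈M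
  ... | false rewrite ∧-zeroʳ (mem F e) = refl
  ... | true with mem F e in e∈F
  ...   | true = refl
  ...   | false with inc (ends H e) v in ie
  ...     | zero = refl
  ...     | suc _ = ⊥-elim (false≢true (trans (sym e∈F)
                      (X⇒F e v (matching⇒core e e∈M) (inc≢0⇒incident e v (λ z → 0≢1+n (trans (sym z) ie))) v∈C)))

  degTerm-F∩matching-outside : ∀ v → mem C v ≡ false → ∀ e → degTerm (F ∩ matching) v e ≡ 0
  degTerm-F∩matching-outside v v∉C e rewrite mem-∩ F matching e with mem F e | degTerm-F-outside v v∉C e
  ... | false | _ = refl
  ... | true | z with mem matching e
  ...   | true = z
  ...   | false = refl

  degree-F∩matching : ∀ v → degree H (F ∩ matching) v ≡ bit (mem C v)
  degree-F∩matching v with mem C v in v∈C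
  ... | true = trans (∑-cong (degTerm-F∩matching v v∈C)) (matching-oneFactor v (C⇒inV v v∈C))
  ... | false = ∑-zero _ (degTerm-F∩matching-outside v v∈C)

  circuit-or-subdivision : IsEvenCircuit H C F ⊎ (Σ ℕ λ p → Σ ℕ λ q → Σ (Multigraph p q) λ K → Cubic K × Subdivision H C F K)
  circuit-or-subdivision with any? (λ v → (mem C v ≟ᵇ true) ×-dec (degree H F v ≟ℕ 3))
  ... | yes v₃ = inj₂ (subdivision-of-cubic H (loopless G) C F F-inside degree-2-or-3 connected-F v₃)
  ... | no ¬v₃ = inj₁ (evenCircuit H C F (F ∩ matching) (IsComponent.nonempty comp) degree-2 degree-F-outside
                        connected-F degree-F∩matching)
    where
    degree-2 : ∀ v → mem C v ≡ true → degree H F v ≡ 2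
    degree-2 v v∈C = [ id , (λ d3 → ⊥-elim (¬v₃ (v , v∈C , d3))) ] (degree-2-or-3 v v∈C)

  module _ {p q} {K : Multigraph p q} (s : Subdivision H C F K) where
    open Subdivision s
    open SubdivisionFacts H (loopless G) s

    triple-single-edge : ∀ e → mem F e ≡ true → mem triple e ≡ true → ∃ λ f → len f ≡ 0 × pedge f zero ≡ e
    triple-single-edge e e∈F e∈T = single-edge-path e e∈F
      (λ v e-at → trans (degree-F v (F-inside e v e∈F e-at)) (triple⇒coreDegree3 v e e∈T e-at))

    triple-at-branch : Cubic K → ∀ x → ∃ λ e → mem triple e ≡ true × Incident H e (branch x)
    triple-at-branch cubicK x with degree-2-or-3 (branch x) (∈⇒mem (branch-in x))
    ... | inj₁ d2 = ⊥-elim (branch-degree≢2 cubicK x d2)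
    ... | inj₂ d3 = coreDegree3⇒triple (branch x) (trans (sym (degree-F _ (∈⇒mem (branch-in x)))) d3)

    mem-lifted : ∀ f → mem (liftedEdges s triple) f ≡ (does (len f ≟ℕ 0) ∧ mem triple (pedge f zero))
    mem-lifted f = lookup∘tabulate _ f

    lifted-oneFactor : Cubic K → OneFactor K (liftedEdges s triple)
    lifted-oneFactor cubicK x with triple-at-branch cubicK x
    ... | t , t∈T , t-at with triple-single-edge t (X⇒F t (branch x) (triple⇒core t t∈T) t-at (∈⇒mem (branch-in x))) t∈T
    ...   | f₀ , single₀ , refl = trans (∑-cong at-x) (∑-single f₀ 1)
      where
      at-x : ∀ f → (if mem (liftedEdges s triple) f then inc (ends K f) x else 0) ≡ (if does (f ≟ f₀) then 1 else 0)
      at-x f rewrite mem-lifted f with f ≟ f₀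
      ... | yes refl = trans (if-single-edge single₀ t∈T)
                         (inc-≡1 _ _ x (single-edge-ends single₀ x t-at) (single-edge-loopless single₀))
      ... | no f≢f₀ = if-single-edge-0 λ single e∈T →
                        inc-≡0 _ _ x (f≢f₀ ∘ same single e∈T ∘ inj₁) (f≢f₀ ∘ same single e∈T ∘ inj₂)
        where
        same : len f ≡ 0 → mem triple (pedge f zero) ≡ true → (proj₁ (ends K f) ≡ x) ⊎ (proj₂ (ends K f) ≡ x) → f ≡ f₀
        same single e∈T at = proj₁ (pedge-unique f zero f₀ zero
          (triple-unique (branch x) _ _ e∈T (single-edge-at single x at) t∈T t-at))

mainTheorem2 : ∀ {n m} (G : Graph n m) → Cubic (mg G) →
    (M₁ M₂ M₃ : Subset m) →
    OneFactor (mg G) M₁ → OneFactor (mg G) M₂ → OneFactor (mg G) M₃ →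
    M₁ ≢ M₂ → M₁ ≢ M₃ → M₂ ≢ M₃ →
    (∀ v → InV (mg G) (coreEdges M₁ M₂ M₃) v → degree (mg G) (𝓜 M₁ M₂ M₃) v ≡ 1)
    ×
    (∀ (C : Subset n) → IsComponent (mg G) (coreEdges M₁ M₂ M₃) C →
      (IsEvenCircuit (mg G) C (compEdges (mg G) (coreEdges M₁ M₂ M₃) C)
        ⊎ (Σ ℕ λ p → Σ ℕ λ q → Σ (Multigraph p q) λ K →
             Cubic K × Subdivision (mg G) C (compEdges (mg G) (coreEdges M₁ M₂ M₃) C) K))
      ×
      (∀ {p q} (K : Multigraph p q) → Cubic K →
        (s : Subdivision (mg G) C (compEdges (mg G) (coreEdges M₁ M₂ M₃) C) K) →
        (∀ e → e ∈ compEdges (mg G) (coreEdges M₁ M₂ M₃) C → e ∈ ((M₁ ∩ M₂) ∩ M₃) →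
           ∃ λ f → (Subdivision.len s f ≡ 0) × (Subdivision.pedge s f zero ≡ e))
        × OneFactor K (liftedEdges s ((M₁ ∩ M₂) ∩ M₃))))
mainTheorem2 G cubic M₁ M₂ M₃ f₁ f₂ f₃ _ _ _ =
  CoreOf.matching-oneFactor G cubic M₁ M₂ M₃ f₁ f₂ f₃ ,
  λ C comp → let open CoreComponent G cubic M₁ M₂ M₃ f₁ f₂ f₃ C comp in
    circuit-or-subdivision ,
    λ K K-cubic s → (λ e e∈F e∈T → triple-single-edge s e (∈⇒mem e∈F) (∈⇒mem e∈T)) , lifted-oneFactor s K-cubic
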